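{- Let $\Bbbk$ be a field of characteristic zero, $N$ a positive integer, $M=\bigoplus_{k\in\frac{1}{N}\mathbb{Z}}M_k$ a graded algebra of type $\frac{1}{N}\mathbb{Z}$ over $\Bbbk$, $\partial$ a derivation of $M$ of degree $2$, and $\mathcal{E}_4\in M_4$. Let $\widetilde{M}=M[\mathcal{E}_2]$ be the polynomial ring over $M$ in an indeterminate $\mathcal{E}_2$ of degree $2$, and let $\mathscr{D}$ be the derivation of $\widetilde{M}$ with $\mathscr{D}(f)=\partial f+k\,\mathcal{E}_2 f$ for $f\in M_k$ and $\mathscr{D}(\mathcal{E}_2)=\mathcal{E}_4+\mathcal{E}_2^2$. For any integer $n\ge0$ and any homogeneous $f\in M_k$, define $$\vartheta^{(n)}f:=\mathscr{D}^{n+1}f-(n+k)[\mathcal{E}_2,f]_{\mathscr{D},n},\qquad \vartheta^{(n)}\mathcal{E}_2:=\big(1+(-1)^n\big)\mathscr{D}^{n+1}\mathcal{E}_2-(n+2)[\mathcal{E}_2,\mathcal{E}_2]_{\mathscr{D},n}.$$ Then $\vartheta^{(n)}f\in M_{k+2+2n}$ and $\vartheta^{(n)}\mathcal{E}_2\in M_{4+2n}$.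
   Context: A graded algebra of type $\frac{1}{N}\mathbb{Z}$ over $\Bbbk$ is a commutative, associative $\Bbbk$-algebra with unit $M=\bigoplus_{k\in\frac{1}{N}\mathbb{Z}}M_k$ with $M_kM_l\subseteq M_{k+l}$, $1\in M_0$, and $\dim_\Bbbk M_k<\infty$; elements of $M_k$ are homogeneous of degree $k$. A derivation has degree $2$ if it maps $M_k$ into $M_{k+2}$. $\widetilde{M}$ is graded with $\mathcal{E}_2$ of degree $2$, and $\mathscr{D}$ maps $\widetilde{M}_k$ to $\widetilde{M}_{k+2}$; $\mathscr{D}^j$ denotes the $j$-th iterate. $(x)_0=1$, $(x)_n=x(x+1)\cdots(x+n-1)$. For homogeneous $f\in\widetilde{M}_k$, $g\in\widetilde{M}_l$ and $n\ge0$, $$[f,g]_{\mathscr{D},n}:=\sum_{j=0}^n(-1)^j\frac{(k+j)_{n-j}(l+n-j)_j}{j!(n-j)!}\,\mathscr{D}^{j}f\,\mathscr{D}^{n-j}g;$$ in particular $\mathcal{E}_2$ is treated as having degree $2$ in $[\mathcal{E}_2,f]_{\mathscr{D},n}$ and $[\mathcal{E}_2,\mathcal{E}_2]_{\mathscr{D},n}$. -}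

module Defs where

open import Level using (Level; _⊔_) renaming (suc to lsuc)
open import Algebra.Bundles using (CommutativeRing)
open import Data.Nat as ℕ using (ℕ; zero; suc; NonZero; _!)
open import Data.Integer as ℤ using (ℤ; +_; -[1+_])
open import Data.List as List using (List; []; _∷_; map; foldr; upTo; replicate; _++_)
open import Data.List.Relation.Unary.All using (All)
open import Data.List.Relation.Unary.Unique.Propositional using (Unique)
open import Data.Vec as Vec using (Vec)
import Data.Vec.Relation.Unary.All as VecAll
open import Data.Product using (Σ; ∃; _×_; _,_; proj₁; proj₂)
open import Data.Unit.Polymorphic using (⊤)
open import Relation.Nullary using (¬_)

module _ {c ℓ} (R : CommutativeRing c ℓ) where
  open CommutativeRing R

  natR : ℕ → Carrier
  natR zero    = 0#
  natR (suc n) = 1# + natR n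

  intR : ℤ → Carrier
  intR (+ n)     = natR n
  intR -[1+ n ]  = - natR (suc n)

record Field (c ℓ : Level) : Set (lsuc (c ⊔ ℓ)) where
  field
    commutativeRing : CommutativeRing c ℓ
  open CommutativeRing commutativeRing public
  field
    1≉0   : ¬ (1# ≈ 0#)
    inv   : (x : Carrier) → ¬ (x ≈ 0#) → Carrier
    inv-l : ∀ x (x≉0 : ¬ (x ≈ 0#)) → inv x x≉0 * x ≈ 1#

CharZero : ∀ {c ℓ} → Field c ℓ → Set ℓ
CharZero K = ∀ n → ¬ (natR commutativeRing (suc n) ≈ 0#)
  where open Field K

-- Graded (commutative, associative, unital) algebras of type (1/N)ℤ
-- over a field K.  The degree k = a/N ∈ (1/N)ℤ is encoded by a : ℤ,
-- and  Hom a x  means  x ∈ M_{a/N}.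

record GradedAlgebra {c ℓ} (K : Field c ℓ) (m ℓm h : Level)
       : Set (lsuc (c ⊔ ℓ ⊔ m ⊔ ℓm ⊔ h)) where
  private module K = Field K
  field
    algRing : CommutativeRing m ℓm
  open CommutativeRing algRing public
  field
    ι      : K.Carrier → Carrier
    ι-cong : ∀ {x y} → x K.≈ y → ι x ≈ ι y
    ι-+    : ∀ x y → ι (x K.+ y) ≈ ι x + ι y
    ι-*    : ∀ x y → ι (x K.* y) ≈ ι x * ι y
    ι-1    : ι K.1# ≈ 1#
    Hom      : ℤ → Carrier → Set h
    Hom-resp : ∀ {a x y} → x ≈ y → Hom a x → Hom a y
    Hom-0    : ∀ {a} → Hom a 0#
    Hom-+    : ∀ {a x y} → Hom a x → Hom a y → Hom a (x + y)
    Hom-ι*   : ∀ {a x} (λ' : K.Carrier) → Hom a x → Hom a (ι λ' * x)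
    Hom-*    : ∀ {a b x y} → Hom a x → Hom b y → Hom (a ℤ.+ b) (x * y)
    Hom-1    : Hom (+ 0) 1#
    decomp   : ∀ x → ∃ λ (ys : List (ℤ × Carrier)) →
                 Unique (map proj₁ ys) ×
                 All (λ p → Hom (proj₁ p) (proj₂ p)) ys ×
                 (x ≈ foldr _+_ 0# (map proj₂ ys))
    indep    : ∀ (ys : List (ℤ × Carrier)) →
                 Unique (map proj₁ ys) →
                 All (λ p → Hom (proj₁ p) (proj₂ p)) ys →
                 foldr _+_ 0# (map proj₂ ys) ≈ 0# →
                 All (λ p → proj₂ p ≈ 0#) ys
    findim   : ∀ a → ∃ λ (d : ℕ) → ∃ λ (vs : Vec Carrier d) →
                 VecAll.All (Hom a) vs ×
                 (∀ x → Hom a x → ∃ λ (cs : Vec K.Carrier d) →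
                    x ≈ Vec.foldr _ _+_ 0# (Vec.zipWith (λ λ' v → ι λ' * v) cs vs))

record Derivation {c ℓ m ℓm h} (K : Field c ℓ) (M : GradedAlgebra K m ℓm h) (N : ℕ)
       : Set (c ⊔ m ⊔ ℓm ⊔ h) where
  private module K = Field K
  open GradedAlgebra M
  field
    ∂      : Carrier → Carrier
    ∂-cong : ∀ {x y} → x ≈ y → ∂ x ≈ ∂ y
    ∂-+    : ∀ x y → ∂ (x + y) ≈ ∂ x + ∂ y
    ∂-ι*   : ∀ (λ' : K.Carrier) x → ∂ (ι λ' * x) ≈ ι λ' * ∂ x
    ∂-*    : ∀ x y → ∂ (x * y) ≈ ∂ x * y + x * ∂ y
    ∂-deg  : ∀ {a x} → Hom a x → Hom (a ℤ.+ ℤ.+ (2 ℕ.* N)) (∂ x)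

module Theory {c ℓ m ℓm h} (K : Field c ℓ) (char0 : CharZero K)
              (N : ℕ) {{_ : NonZero N}}
              (M : GradedAlgebra K m ℓm h) (δ : Derivation K M N)
              (E₄ : GradedAlgebra.Carrier M) where

  private module K = Field K
  open GradedAlgebra M
  open Derivation δ

  -- 1/n in K for n ≥ 1 (the value at 0 is irrelevant and never used)
  invNat : ℕ → K.Carrier
  invNat zero    = K.0#
  invNat (suc n) = K.inv (natR K.commutativeRing (suc n)) (char0 n)

  deg : ℤ → K.Carrier
  deg a = intR K.commutativeRing a K.* invNat N

  natK : ℕ → K.Carrier
  natK = natR K.commutativeRing

  rising : K.Carrier → ℕ → K.Carrier
  rising x zero    = K.1#
  rising x (suc n) = rising x n K.* (x K.+ natK n)

  sgn : ℕ → K.Carrier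
  sgn zero    = K.1#
  sgn (suc n) = K.- sgn n

  -- elements of M̃ = M[E₂]: coefficient lists (constant term first)
  Poly : Set m
  Poly = List Carrier

  infixl 6 _⊕_
  _⊕_ : Poly → Poly → Poly
  []       ⊕ q        = q
  (x ∷ p)  ⊕ []       = x ∷ p
  (x ∷ p)  ⊕ (y ∷ q)  = (x + y) ∷ (p ⊕ q)

  infixl 7 _⊗_
  _⊗_ : Poly → Poly → Poly
  []      ⊗ q = []
  (x ∷ p) ⊗ q = map (x *_) q ⊕ (0# ∷ (p ⊗ q))

  infixr 7 _·_
  _·_ : K.Carrier → Poly → Poly
  λ' · p = map (ι λ' *_) p

  infixl 6 _⊖_
  _⊖_ : Poly → Poly → Poly
  p ⊖ q = p ⊕ (K.- K.1#) · q

  const : Carrier → Poly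
  const x = x ∷ []

  E₂ : Poly
  E₂ = 0# ∷ 1# ∷ []

  E₂^ : ℕ → Poly
  E₂^ i = replicate i 0# ++ (1# ∷ [])

  𝒟E₂ : Poly
  𝒟E₂ = E₄ ∷ 0# ∷ 1# ∷ []

  𝒟E₂^ : ℕ → Poly
  𝒟E₂^ zero    = []
  𝒟E₂^ (suc i) = natK (suc i) · (E₂^ i ⊗ 𝒟E₂)

  -- 𝒟 on the homogeneous part M̃_{a/N} of M̃: an element Σ cᵢ E₂^i of M̃_{a/N}
  -- has cᵢ ∈ M_{a/N - 2i}, so 𝒟(cᵢ) = ∂cᵢ + (a/N - 2i) E₂ cᵢ, and by Leibniz
  -- 𝒟(cᵢ E₂^i) = 𝒟(cᵢ) E₂^i + cᵢ 𝒟(E₂^i).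
  𝒟-from : ℤ → ℕ → Poly → Poly
  𝒟-from a i []       = []
  𝒟-from a i (x ∷ p)  =
      (((∂ x ∷ []) ⊕ (deg (a ℤ.- ℤ.+ (2 ℕ.* N ℕ.* i)) · (0# ∷ x ∷ []))) ⊗ E₂^ i)
    ⊕ (const x ⊗ 𝒟E₂^ i)
    ⊕ 𝒟-from a (suc i) p

  𝒟 : ℤ → Poly → Poly
  𝒟 a = 𝒟-from a 0

  𝒟^ : ℕ → ℤ → Poly → Poly
  𝒟^ zero    a p = p
  𝒟^ (suc j) a p = 𝒟 (a ℤ.+ ℤ.+ (2 ℕ.* N ℕ.* j)) (𝒟^ j a p)

  sumP : List Poly → Poly
  sumP = foldr _⊕_ []

  bracket : ℤ → Poly → ℤ → Poly → ℕ → Poly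
  bracket a f b g n = sumP (map term (upTo (suc n)))
    where
      term : ℕ → Poly
      term j = (sgn j K.* rising (deg a K.+ natK j) (n ℕ.∸ j)
                      K.* rising (deg b K.+ natK (n ℕ.∸ j)) j
                      K.* invNat (j ! ℕ.* (n ℕ.∸ j) !))
               · (𝒟^ j a f ⊗ 𝒟^ (n ℕ.∸ j) b g)

  two : ℤ
  two = ℤ.+ (2 ℕ.* N)

  ϑ : ℕ → ℤ → Carrier → Poly
  ϑ n a f = 𝒟^ (suc n) a (const f)
          ⊖ (natK n K.+ deg a) · bracket two E₂ a (const f) n

  ϑE₂ : ℕ → Poly
  ϑE₂ n = (K.1# K.+ sgn n) · 𝒟^ (suc n) two E₂
        ⊖ (natK n K.+ natK 2) · bracket two E₂ two E₂ n

  InM : ℤ → Poly → Set (m ⊔ ℓm ⊔ h)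
  InM a []      = ⊤
  InM a (x ∷ p) = Hom a x × All (_≈ 0#) p

-- Let Δ = ∂/∂E₂ on M̃ = M[E₂]. In characteristic zero a homogeneous element of M̃ lies in M
-- exactly when Δ kills it, so it suffices to show Δϑ⁽ⁿ⁾ = 0. On M̃_k the commutator [Δ, 𝒟] is
-- multiplication by k, and both f ∈ M_k and E₂ satisfy Δ𝒟F = kF; by induction
-- Δ𝒟^{m+1}F = (m+1)(k+m)𝒟^m F. Applying Δ to [F,G]_{𝒟,n} with the Leibniz rule, consecutive
-- terms cancel, leaving only the terms containing ΔF and ΔG; the coefficients in ϑ⁽ⁿ⁾ are
-- precisely those for which these cancel Δ𝒟^{n+1}F.

{-# OPTIONS --safe #-}
module Submission where

open import Defs
open import Level using (Level)
open import Data.Nat as ℕ using (ℕ; NonZero; zero; suc; _!)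
open import Data.Integer as ℤ using (ℤ)
open import Data.Product using (_×_; _,_)
open import Data.List using ([]; _∷_; map; applyUpTo)
open import Data.List.Relation.Unary.All as All using (All)
open import Data.Unit.Polymorphic using (⊤; tt)
open import Algebra.Bundles using (CommutativeRing)
open import Relation.Binary.Bundles using (Setoid)
open import Relation.Binary.PropositionalEquality as ≡ using (_≡_)
import Relation.Binary.Reasoning.Setoid as SetoidReasoning
import Data.Nat.Properties as ℕP
import Data.Integer.Properties as ℤP
import Data.List.Properties as ListP
import Data.Integer.Solver
import Data.Nat.Solver
import Algebra.Properties.Ring as RingProperties
import Algebra.Properties.Group as GroupProperties
import Algebra.Properties.AbelianGroup as AbelianGroupProperties
import Algebra.Solver.Ring.NaturalCoefficients.Default as SemiringSolver

module ℤSolver = Data.Integer.Solver.+-*-Solver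
module ℕSolver = Data.Nat.Solver.+-*-Solver

module _ {c ℓ} (R : CommutativeRing c ℓ) where
  open CommutativeRing R
  open SetoidReasoning setoid
  open SemiringSolver commutativeSemiring using (solve; _:+_; _:*_; _:=_; con)
  open GroupProperties +-group using (ε⁻¹≈ε)
  open AbelianGroupProperties +-abelianGroup using (⁻¹-∙-comm)

  natR-+ : ∀ m n → natR R (m ℕ.+ n) ≈ natR R m + natR R n
  natR-+ zero    n = sym (+-identityˡ _)
  natR-+ (suc m) n = trans (+-congˡ (natR-+ m n)) (sym (+-assoc _ _ _))

  natR-* : ∀ m n → natR R (m ℕ.* n) ≈ natR R m * natR R n
  natR-* zero    n = sym (zeroˡ _)
  natR-* (suc m) n = begin
    natR R (n ℕ.+ m ℕ.* n)          ≈⟨ trans (natR-+ n (m ℕ.* n)) (+-congˡ (natR-* m n)) ⟩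
    natR R n + natR R m * natR R n  ≈⟨ solve 2 (λ a b → a :+ b :* a := (con 1 :+ b) :* a) refl (natR R n) (natR R m) ⟩
    (1# + natR R m) * natR R n      ∎

  private
    1-[1+x]≈-x : ∀ x → 1# + - (1# + x) ≈ - x
    1-[1+x]≈-x x = begin
      1# + - (1# + x)    ≈⟨ +-congˡ (⁻¹-∙-comm 1# x) ⟨
      1# + (- 1# + - x)  ≈⟨ +-assoc 1# (- 1#) (- x) ⟨
      (1# + - 1#) + - x  ≈⟨ +-congʳ (-‿inverseʳ 1#) ⟩
      0# + - x           ≈⟨ +-identityˡ (- x) ⟩
      - x                ∎

    intR-suc : ∀ z → intR R (ℤ.suc z) ≈ 1# + intR R z
    intR-suc (ℤ.+ n)          = refl
    intR-suc ℤ.-[1+ zero ]    = sym (trans (1-[1+x]≈-x 0#) ε⁻¹≈ε)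
    intR-suc ℤ.-[1+ suc n ]   = sym (1-[1+x]≈-x (natR R (suc n)))

  intR-+natR : ∀ z n → intR R (z ℤ.+ ℤ.+ n) ≈ intR R z + natR R n
  intR-+natR z zero    = trans (reflexive (≡.cong (intR R) (ℤP.+-identityʳ z))) (sym (+-identityʳ _))
  intR-+natR z (suc n) = begin
    intR R (z ℤ.+ ℤ.+ suc n)      ≡⟨ ≡.cong (intR R) z+[1+n]≡suc[z+n] ⟩
    intR R (ℤ.suc (z ℤ.+ ℤ.+ n))  ≈⟨ intR-suc (z ℤ.+ ℤ.+ n) ⟩
    1# + intR R (z ℤ.+ ℤ.+ n)     ≈⟨ +-congˡ (intR-+natR z n) ⟩
    1# + (intR R z + natR R n)    ≈⟨ solve 2 (λ a b → con 1 :+ (a :+ b) := a :+ (con 1 :+ b)) refl (intR R z) (natR R n) ⟩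
    intR R z + (1# + natR R n)    ∎
    where
    z+[1+n]≡suc[z+n] : z ℤ.+ ℤ.+ suc n ≡ ℤ.suc (z ℤ.+ ℤ.+ n)
    z+[1+n]≡suc[z+n] = ≡.trans (≡.cong (λ w → z ℤ.+ w) (ℤP.pos-+ 1 n))
      (ℤS.solve 2 (λ z n → z ℤS.:+ (ℤS.con 1ℤ ℤS.:+ n) ℤS.:= ℤS.con 1ℤ ℤS.:+ (z ℤS.:+ n)) ≡.refl z (ℤ.+ n))
      where module ℤS = ℤSolver
            1ℤ = ℤ.+ 1

module M̃ {ℓ₁ ℓ₂ ℓ₃ ℓ₄ ℓ₅ : Level} (K : Field ℓ₁ ℓ₂) (char0 : CharZero K)
         (N : ℕ) {{_ : NonZero N}}
         (M : GradedAlgebra K ℓ₃ ℓ₄ ℓ₅) (δ : Derivation K M N)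
         (E₄ : GradedAlgebra.Carrier M) where

  open Theory K char0 N M δ E₄
  open GradedAlgebra M hiding (zero)
  open Derivation δ
  private
    module K  = Field K
    module KS = SemiringSolver K.commutativeSemiring
    module MS = SemiringSolver commutativeSemiring

  coeff : Poly → ℕ → Carrier
  coeff []      _       = 0#
  coeff (x ∷ p) zero    = x
  coeff (x ∷ p) (suc j) = coeff p j

  -- Equality in M̃ is coefficientwise, so trailing zeros do not matter.
  infix 4 _≋_
  record _≋_ (p q : Poly) : Set ℓ₄ where
    constructor coeffwise
    field at : ∀ j → coeff p j ≈ coeff q j
  open _≋_

  ≋-refl : ∀ {p} → p ≋ p
  ≋-refl = coeffwise λ _ → refl

  ≋-sym : ∀ {p q} → p ≋ q → q ≋ p
  ≋-sym e = coeffwise λ j → sym (at e j)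

  ≋-trans : ∀ {p q r} → p ≋ q → q ≋ r → p ≋ r
  ≋-trans e f = coeffwise λ j → trans (at e j) (at f j)

  ≋-setoid : Setoid ℓ₃ ℓ₄
  ≋-setoid = record
    { Carrier       = Poly
    ; _≈_           = _≋_
    ; isEquivalence = record { refl = ≋-refl ; sym = ≋-sym ; trans = ≋-trans }
    }

  module ≋-Reasoning = SetoidReasoning ≋-setoid

  infixr 7 _⋆_
  _⋆_ : Carrier → Poly → Poly
  x ⋆ p = map (x *_) p

  coeff-⊕ : ∀ p q j → coeff (p ⊕ q) j ≈ coeff p j + coeff q j
  coeff-⊕ []      q       j       = sym (+-identityˡ _)
  coeff-⊕ (x ∷ p) []      j       = sym (+-identityʳ _)
  coeff-⊕ (x ∷ p) (y ∷ q) zero    = refl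
  coeff-⊕ (x ∷ p) (y ∷ q) (suc j) = coeff-⊕ p q j

  coeff-⋆ : ∀ x p j → coeff (x ⋆ p) j ≈ x * coeff p j
  coeff-⋆ x []      j       = sym (zeroʳ x)
  coeff-⋆ x (y ∷ p) zero    = refl
  coeff-⋆ x (y ∷ p) (suc j) = coeff-⋆ x p j

  coeff-· : ∀ l p j → coeff (l · p) j ≈ ι l * coeff p j
  coeff-· l = coeff-⋆ (ι l)

  ≋-tail : ∀ {x y p q} → (x ∷ p) ≋ (y ∷ q) → p ≋ q
  ≋-tail e = coeffwise λ j → at e (suc j)

  ≋[]-tail : ∀ {x p} → (x ∷ p) ≋ [] → p ≋ []
  ≋[]-tail e = coeffwise λ j → at e (suc j)

  ∷-cong : ∀ {x y p q} → x ≈ y → p ≋ q → (x ∷ p) ≋ (y ∷ q)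
  ∷-cong e f = coeffwise λ { zero → e ; (suc j) → at f j }

  0∷[]≋[] : (0# ∷ []) ≋ []
  0∷[]≋[] = coeffwise λ { zero → refl ; (suc j) → refl }

  ⊕-cong : ∀ {p p′ q q′} → p ≋ p′ → q ≋ q′ → p ⊕ q ≋ p′ ⊕ q′
  ⊕-cong {p} {p′} {q} {q′} e f = coeffwise λ j →
    trans (coeff-⊕ p q j) (trans (+-cong (at e j) (at f j)) (sym (coeff-⊕ p′ q′ j)))

  ⊕-congˡ : ∀ p {q q′} → q ≋ q′ → p ⊕ q ≋ p ⊕ q′
  ⊕-congˡ p = ⊕-cong (≋-refl {p})

  ⊕-congʳ : ∀ q {p p′} → p ≋ p′ → p ⊕ q ≋ p′ ⊕ q
  ⊕-congʳ q e = ⊕-cong e (≋-refl {q})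

  ⊕-identityʳ : ∀ p → p ⊕ [] ≋ p
  ⊕-identityʳ p = coeffwise λ j → trans (coeff-⊕ p [] j) (+-identityʳ _)

  ⊕-comm : ∀ p q → p ⊕ q ≋ q ⊕ p
  ⊕-comm p q = coeffwise λ j → trans (coeff-⊕ p q j) (trans (+-comm _ _) (sym (coeff-⊕ q p j)))

  ⊕-assoc : ∀ p q r → (p ⊕ q) ⊕ r ≋ p ⊕ (q ⊕ r)
  ⊕-assoc p q r = coeffwise λ j → begin
    coeff ((p ⊕ q) ⊕ r) j              ≈⟨ trans (coeff-⊕ (p ⊕ q) r j) (+-congʳ (coeff-⊕ p q j)) ⟩
    (coeff p j + coeff q j) + coeff r j  ≈⟨ +-assoc _ _ _ ⟩
    coeff p j + (coeff q j + coeff r j)  ≈⟨ trans (coeff-⊕ p (q ⊕ r) j) (+-congˡ (coeff-⊕ q r j)) ⟨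
    coeff (p ⊕ (q ⊕ r)) j              ∎
    where open SetoidReasoning setoid

  ⊕-interchange : ∀ p q r s → (p ⊕ q) ⊕ (r ⊕ s) ≋ (p ⊕ r) ⊕ (q ⊕ s)
  ⊕-interchange p q r s = begin
    (p ⊕ q) ⊕ (r ⊕ s)  ≈⟨ ⊕-assoc p q (r ⊕ s) ⟩
    p ⊕ (q ⊕ (r ⊕ s))  ≈⟨ ⊕-congˡ p (⊕-assoc q r s) ⟨
    p ⊕ ((q ⊕ r) ⊕ s)  ≈⟨ ⊕-congˡ p (⊕-congʳ s (⊕-comm q r)) ⟩
    p ⊕ ((r ⊕ q) ⊕ s)  ≈⟨ ⊕-congˡ p (⊕-assoc r q s) ⟩
    p ⊕ (r ⊕ (q ⊕ s))  ≈⟨ ⊕-assoc p r (q ⊕ s) ⟨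
    (p ⊕ r) ⊕ (q ⊕ s)  ∎
    where open ≋-Reasoning

  0∷-⊕ : ∀ p q → (0# ∷ p ⊕ q) ≋ (0# ∷ p) ⊕ (0# ∷ q)
  0∷-⊕ p q = ∷-cong (sym (+-identityʳ 0#)) ≋-refl

  ⊕-split₂ : ∀ x y p q → (x ∷ p) ⊕ (0# ∷ y ∷ q) ≋ (x ∷ y ∷ []) ⊕ (0# ∷ (p ⊕ (0# ∷ q)))
  ⊕-split₂ x y p q = ∷-cong refl (begin
    p ⊕ (y ∷ q)                       ≈⟨ ⊕-congˡ p (∷-cong (+-identityʳ y) ≋-refl) ⟨
    p ⊕ (const y ⊕ (0# ∷ q))          ≈⟨ ⊕-assoc p (const y) (0# ∷ q) ⟨
    (p ⊕ const y) ⊕ (0# ∷ q)          ≈⟨ ⊕-congʳ (0# ∷ q) (⊕-comm p (const y)) ⟩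
    (const y ⊕ p) ⊕ (0# ∷ q)          ≈⟨ ⊕-assoc (const y) p (0# ∷ q) ⟩
    const y ⊕ (p ⊕ (0# ∷ q))          ∎)
    where open ≋-Reasoning

  ⋆-cong : ∀ {x y p q} → x ≈ y → p ≋ q → x ⋆ p ≋ y ⋆ q
  ⋆-cong {x} {y} {p} {q} e f = coeffwise λ j →
    trans (coeff-⋆ x p j) (trans (*-cong e (at f j)) (sym (coeff-⋆ y q j)))

  ⋆-zeroˡ : ∀ {x} p → x ≈ 0# → x ⋆ p ≋ []
  ⋆-zeroˡ {x} p e = coeffwise λ j → trans (coeff-⋆ x p j) (trans (*-congʳ e) (zeroˡ _))

  ⋆-distribˡ : ∀ x p q → x ⋆ (p ⊕ q) ≋ x ⋆ p ⊕ x ⋆ q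
  ⋆-distribˡ x p q = coeffwise λ j → begin
    coeff (x ⋆ (p ⊕ q)) j               ≈⟨ trans (coeff-⋆ x (p ⊕ q) j) (*-congˡ (coeff-⊕ p q j)) ⟩
    x * (coeff p j + coeff q j)          ≈⟨ distribˡ x _ _ ⟩
    x * coeff p j + x * coeff q j        ≈⟨ trans (coeff-⊕ (x ⋆ p) (x ⋆ q) j) (+-cong (coeff-⋆ x p j) (coeff-⋆ x q j)) ⟨
    coeff (x ⋆ p ⊕ x ⋆ q) j             ∎
    where open SetoidReasoning setoid

  ⋆-distribʳ : ∀ x y p → (x + y) ⋆ p ≋ x ⋆ p ⊕ y ⋆ p
  ⋆-distribʳ x y p = coeffwise λ j → begin
    coeff ((x + y) ⋆ p) j               ≈⟨ trans (coeff-⋆ (x + y) p j) (distribʳ _ x y) ⟩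
    x * coeff p j + y * coeff p j        ≈⟨ trans (coeff-⊕ (x ⋆ p) (y ⋆ p) j) (+-cong (coeff-⋆ x p j) (coeff-⋆ y p j)) ⟨
    coeff (x ⋆ p ⊕ y ⋆ p) j             ∎
    where open SetoidReasoning setoid

  ⋆-assoc : ∀ x y p → (x * y) ⋆ p ≋ x ⋆ y ⋆ p
  ⋆-assoc x y p = coeffwise λ j → begin
    coeff ((x * y) ⋆ p) j       ≈⟨ trans (coeff-⋆ (x * y) p j) (*-assoc x y _) ⟩
    x * (y * coeff p j)          ≈⟨ trans (coeff-⋆ x (y ⋆ p) j) (*-congˡ (coeff-⋆ y p j)) ⟨
    coeff (x ⋆ y ⋆ p) j         ∎
    where open SetoidReasoning setoid

  ⋆-comm : ∀ x y p → x ⋆ y ⋆ p ≋ y ⋆ x ⋆ p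
  ⋆-comm x y p = ≋-trans (≋-sym (⋆-assoc x y p)) (≋-trans (⋆-cong (*-comm x y) ≋-refl) (⋆-assoc y x p))

  ⋆-0∷ : ∀ x p → x ⋆ (0# ∷ p) ≋ (0# ∷ x ⋆ p)
  ⋆-0∷ x p = ∷-cong (zeroʳ x) ≋-refl

  ⋆-identityˡ : ∀ p → 1# ⋆ p ≋ p
  ⋆-identityˡ p = coeffwise λ j → trans (coeff-⋆ 1# p j) (*-identityˡ _)

  0∷-⊗ : ∀ p q → (0# ∷ p) ⊗ q ≋ (0# ∷ p ⊗ q)
  0∷-⊗ p q = ⊕-congʳ (0# ∷ p ⊗ q) (⋆-zeroˡ q refl)

  ⊗-zeroˡ : ∀ {p} q → p ≋ [] → p ⊗ q ≋ []
  ⊗-zeroˡ {[]}    q e = ≋-refl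
  ⊗-zeroˡ {x ∷ p} q e = ≋-trans (⊕-cong (⋆-zeroˡ q (at e zero)) (∷-cong refl (⊗-zeroˡ q (≋[]-tail e)))) 0∷[]≋[]

  ⊗-zeroʳ : ∀ p → p ⊗ [] ≋ []
  ⊗-zeroʳ []      = ≋-refl
  ⊗-zeroʳ (x ∷ p) = ≋-trans (∷-cong refl (⊗-zeroʳ p)) 0∷[]≋[]

  ⊗-congˡ : ∀ {p p′} q → p ≋ p′ → p ⊗ q ≋ p′ ⊗ q
  ⊗-congˡ {[]}    {p′}     q e = ≋-sym (⊗-zeroˡ q (≋-sym e))
  ⊗-congˡ {x ∷ p} {[]}     q e = ⊗-zeroˡ q e
  ⊗-congˡ {x ∷ p} {y ∷ p′} q e = ⊕-cong (⋆-cong (at e zero) ≋-refl) (∷-cong refl (⊗-congˡ {p} {p′} q (≋-tail e)))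

  ⊗-congʳ : ∀ p {q q′} → q ≋ q′ → p ⊗ q ≋ p ⊗ q′
  ⊗-congʳ []      e = ≋-refl
  ⊗-congʳ (x ∷ p) e = ⊕-cong (⋆-cong refl e) (∷-cong refl (⊗-congʳ p e))

  ⊗-distribʳ : ∀ p p′ q → (p ⊕ p′) ⊗ q ≋ p ⊗ q ⊕ p′ ⊗ q
  ⊗-distribʳ []      p′       q = ≋-refl
  ⊗-distribʳ (x ∷ p) []       q = ≋-sym (⊕-identityʳ _)
  ⊗-distribʳ (x ∷ p) (y ∷ p′) q = begin
    (x + y) ⋆ q ⊕ (0# ∷ (p ⊕ p′) ⊗ q)
      ≈⟨ ⊕-cong (⋆-distribʳ x y q) (≋-trans (∷-cong refl (⊗-distribʳ p p′ q)) (0∷-⊕ (p ⊗ q) (p′ ⊗ q))) ⟩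
    (x ⋆ q ⊕ y ⋆ q) ⊕ ((0# ∷ p ⊗ q) ⊕ (0# ∷ p′ ⊗ q))
      ≈⟨ ⊕-interchange (x ⋆ q) (y ⋆ q) (0# ∷ p ⊗ q) (0# ∷ p′ ⊗ q) ⟩
    (x ⋆ q ⊕ (0# ∷ p ⊗ q)) ⊕ (y ⋆ q ⊕ (0# ∷ p′ ⊗ q))
      ∎
    where open ≋-Reasoning

  ⋆-⊗ : ∀ x p q → (x ⋆ p) ⊗ q ≋ x ⋆ (p ⊗ q)
  ⋆-⊗ x []      q = ≋-refl
  ⋆-⊗ x (y ∷ p) q = begin
    (x * y) ⋆ q ⊕ (0# ∷ (x ⋆ p) ⊗ q)  ≈⟨ ⊕-cong (⋆-assoc x y q) (∷-cong refl (⋆-⊗ x p q)) ⟩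
    x ⋆ y ⋆ q ⊕ (0# ∷ x ⋆ (p ⊗ q))    ≈⟨ ⊕-congˡ (x ⋆ y ⋆ q) (⋆-0∷ x (p ⊗ q)) ⟨
    x ⋆ y ⋆ q ⊕ x ⋆ (0# ∷ p ⊗ q)      ≈⟨ ⋆-distribˡ x (y ⋆ q) (0# ∷ p ⊗ q) ⟨
    x ⋆ (y ⋆ q ⊕ (0# ∷ p ⊗ q))        ∎
    where open ≋-Reasoning

  ⊗-⋆ : ∀ x p q → p ⊗ (x ⋆ q) ≋ x ⋆ (p ⊗ q)
  ⊗-⋆ x []      q = ≋-refl
  ⊗-⋆ x (y ∷ p) q = begin
    y ⋆ x ⋆ q ⊕ (0# ∷ p ⊗ (x ⋆ q))  ≈⟨ ⊕-cong (⋆-comm y x q) (∷-cong refl (⊗-⋆ x p q)) ⟩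
    x ⋆ y ⋆ q ⊕ (0# ∷ x ⋆ (p ⊗ q))  ≈⟨ ⊕-congˡ (x ⋆ y ⋆ q) (⋆-0∷ x (p ⊗ q)) ⟨
    x ⋆ y ⋆ q ⊕ x ⋆ (0# ∷ p ⊗ q)    ≈⟨ ⋆-distribˡ x (y ⋆ q) (0# ∷ p ⊗ q) ⟨
    x ⋆ (y ⋆ q ⊕ (0# ∷ p ⊗ q))      ∎
    where open ≋-Reasoning

  const-⊗ : ∀ x q → const x ⊗ q ≋ x ⋆ q
  const-⊗ x q = ≋-trans (⊕-congˡ (x ⋆ q) 0∷[]≋[]) (⊕-identityʳ (x ⋆ q))

  ⊗-identityˡ : ∀ q → const 1# ⊗ q ≋ q
  ⊗-identityˡ q = ≋-trans (const-⊗ 1# q) (⋆-identityˡ q)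

  ⊗-identityʳ : ∀ p → p ⊗ const 1# ≋ p
  ⊗-identityʳ []      = ≋-refl
  ⊗-identityʳ (x ∷ p) = ∷-cong (trans (+-identityʳ _) (*-identityʳ x)) (⊗-identityʳ p)

  ι-0 : ι K.0# ≈ 0#
  ι-0 = x+x≈x⇒x≈0 (ι K.0#) (trans (sym (ι-+ K.0# K.0#)) (ι-cong (K.+-identityʳ K.0#)))
    where open RingProperties ring using (x+x≈x⇒x≈0)

  ι-natK-suc : ∀ n → ι (natK (suc n)) ≈ 1# + ι (natK n)
  ι-natK-suc n = trans (ι-+ K.1# (natK n)) (+-congʳ ι-1)

  ι-natK-1 : ι (natK 1) ≈ 1#
  ι-natK-1 = trans (ι-natK-suc 0) (trans (+-congˡ ι-0) (+-identityʳ 1#))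

  ·-cong : ∀ {l l′ p q} → l K.≈ l′ → p ≋ q → l · p ≋ l′ · q
  ·-cong e = ⋆-cong (ι-cong e)

  ·-distribʳ : ∀ l l′ p → (l K.+ l′) · p ≋ l · p ⊕ l′ · p
  ·-distribʳ l l′ p = ≋-trans (⋆-cong (ι-+ l l′) ≋-refl) (⋆-distribʳ _ _ p)

  ·-assoc : ∀ l l′ p → (l K.* l′) · p ≋ l · l′ · p
  ·-assoc l l′ p = ≋-trans (⋆-cong (ι-* l l′) ≋-refl) (⋆-assoc _ _ p)

  ·-identityˡ : ∀ p → K.1# · p ≋ p
  ·-identityˡ p = ≋-trans (⋆-cong ι-1 ≋-refl) (⋆-identityˡ p)

  ·-zeroˡ : ∀ p → K.0# · p ≋ []
  ·-zeroˡ p = ⋆-zeroˡ p ι-0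

  Δ : Poly → Poly
  Δ []      = []
  Δ (x ∷ p) = p ⊕ (0# ∷ Δ p)

  coeff-Δ : ∀ p j → coeff (Δ p) j ≈ ι (natK (suc j)) * coeff p (suc j)
  coeff-Δ []      j       = sym (zeroʳ _)
  coeff-Δ (x ∷ p) zero    = begin
    coeff (p ⊕ (0# ∷ Δ p)) 0   ≈⟨ trans (coeff-⊕ p (0# ∷ Δ p) 0) (+-identityʳ _) ⟩
    coeff p 0                  ≈⟨ trans (*-congʳ ι-natK-1) (*-identityˡ _) ⟨
    ι (natK 1) * coeff p 0     ∎
    where open SetoidReasoning setoid
  coeff-Δ (x ∷ p) (suc j) = begin
    coeff (p ⊕ (0# ∷ Δ p)) (suc j)
      ≈⟨ trans (coeff-⊕ p (0# ∷ Δ p) (suc j)) (+-congˡ (coeff-Δ p j)) ⟩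
    coeff p (suc j) + ι (natK (suc j)) * coeff p (suc j)
      ≈⟨ MS.solve 2 (λ c n → c :+ n :* c := (con 1 :+ n) :* c) refl _ _ ⟩
    (1# + ι (natK (suc j))) * coeff p (suc j)
      ≈⟨ *-congʳ (ι-natK-suc (suc j)) ⟨
    ι (natK (suc (suc j))) * coeff p (suc j)
      ∎
    where open SetoidReasoning setoid
          open MS using (_:+_; _:*_; _:=_; con)

  Δ-cong : ∀ {p q} → p ≋ q → Δ p ≋ Δ q
  Δ-cong {p} {q} e = coeffwise λ j → trans (coeff-Δ p j) (trans (*-congˡ (at e (suc j))) (sym (coeff-Δ q j)))

  Δ-⊕ : ∀ p q → Δ (p ⊕ q) ≋ Δ p ⊕ Δ q
  Δ-⊕ p q = coeffwise λ j → begin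
    coeff (Δ (p ⊕ q)) j
      ≈⟨ trans (coeff-Δ (p ⊕ q) j) (*-congˡ (coeff-⊕ p q (suc j))) ⟩
    ι (natK (suc j)) * (coeff p (suc j) + coeff q (suc j))
      ≈⟨ distribˡ _ _ _ ⟩
    ι (natK (suc j)) * coeff p (suc j) + ι (natK (suc j)) * coeff q (suc j)
      ≈⟨ trans (coeff-⊕ (Δ p) (Δ q) j) (+-cong (coeff-Δ p j) (coeff-Δ q j)) ⟨
    coeff (Δ p ⊕ Δ q) j
      ∎
    where open SetoidReasoning setoid

  Δ-⋆ : ∀ x p → Δ (x ⋆ p) ≋ x ⋆ Δ p
  Δ-⋆ x p = coeffwise λ j → begin
    coeff (Δ (x ⋆ p)) j                       ≈⟨ trans (coeff-Δ (x ⋆ p) j) (*-congˡ (coeff-⋆ x p (suc j))) ⟩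
    ι (natK (suc j)) * (x * coeff p (suc j))  ≈⟨ x∙yz≈y∙xz _ x _ ⟩
    x * (ι (natK (suc j)) * coeff p (suc j))  ≈⟨ trans (coeff-⋆ x (Δ p) j) (*-congˡ (coeff-Δ p j)) ⟨
    coeff (x ⋆ Δ p) j                         ∎
    where open SetoidReasoning setoid
          open import Algebra.Properties.CommutativeSemigroup *-commutativeSemigroup using (x∙yz≈y∙xz)

  Δ-const : ∀ x → Δ (const x) ≋ []
  Δ-const x = 0∷[]≋[]

  Δ-E₂ : Δ E₂ ≋ const 1#
  Δ-E₂ = ∷-cong (+-identityʳ 1#) 0∷[]≋[]

  Δ-⊗ : ∀ p q → Δ (p ⊗ q) ≋ Δ p ⊗ q ⊕ p ⊗ Δ q
  Δ-⊗ []      q = ≋-refl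
  Δ-⊗ (x ∷ p) q = begin
    Δ (x ⋆ q ⊕ (0# ∷ p ⊗ q))
      ≈⟨ Δ-⊕ (x ⋆ q) (0# ∷ p ⊗ q) ⟩
    Δ (x ⋆ q) ⊕ (p ⊗ q ⊕ (0# ∷ Δ (p ⊗ q)))
      ≈⟨ ⊕-cong (Δ-⋆ x q) (⊕-congˡ (p ⊗ q) (≋-trans (∷-cong refl (Δ-⊗ p q)) (0∷-⊕ (Δ p ⊗ q) (p ⊗ Δ q)))) ⟩
    x ⋆ Δ q ⊕ (p ⊗ q ⊕ ((0# ∷ Δ p ⊗ q) ⊕ (0# ∷ p ⊗ Δ q)))
      ≈⟨ shuffle (x ⋆ Δ q) (p ⊗ q) (0# ∷ Δ p ⊗ q) (0# ∷ p ⊗ Δ q) ⟩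
    (p ⊗ q ⊕ (0# ∷ Δ p ⊗ q)) ⊕ (x ⋆ Δ q ⊕ (0# ∷ p ⊗ Δ q))
      ≈⟨ ⊕-congʳ (x ⋆ Δ q ⊕ (0# ∷ p ⊗ Δ q))
                 (≋-trans (⊗-distribʳ p (0# ∷ Δ p) q) (⊕-congˡ (p ⊗ q) (0∷-⊗ (Δ p) q))) ⟨
    (p ⊕ (0# ∷ Δ p)) ⊗ q ⊕ (x ⋆ Δ q ⊕ (0# ∷ p ⊗ Δ q))
      ∎
    where
    open ≋-Reasoning
    shuffle : ∀ a b c d → a ⊕ (b ⊕ (c ⊕ d)) ≋ (b ⊕ c) ⊕ (a ⊕ d)
    shuffle a b c d = begin
      a ⊕ (b ⊕ (c ⊕ d))  ≈⟨ ⊕-congˡ a (⊕-assoc b c d) ⟨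
      a ⊕ ((b ⊕ c) ⊕ d)  ≈⟨ ⊕-comm a ((b ⊕ c) ⊕ d) ⟩
      ((b ⊕ c) ⊕ d) ⊕ a  ≈⟨ ⊕-assoc (b ⊕ c) d a ⟩
      (b ⊕ c) ⊕ (d ⊕ a)  ≈⟨ ⊕-congˡ (b ⊕ c) (⊕-comm d a) ⟩
      (b ⊕ c) ⊕ (a ⊕ d)  ∎

  shift : ℕ → Poly → Poly
  shift zero    p = p
  shift (suc i) p = 0# ∷ shift i p

  shift-cong : ∀ i {p q} → p ≋ q → shift i p ≋ shift i q
  shift-cong zero    e = e
  shift-cong (suc i) e = ∷-cong refl (shift-cong i e)

  shift-[] : ∀ i → shift i [] ≋ []
  shift-[] zero    = ≋-refl
  shift-[] (suc i) = ≋-trans (∷-cong refl (shift-[] i)) 0∷[]≋[]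

  shift-⊕ : ∀ i p q → shift i (p ⊕ q) ≋ shift i p ⊕ shift i q
  shift-⊕ zero    p q = ≋-refl
  shift-⊕ (suc i) p q = ≋-trans (∷-cong refl (shift-⊕ i p q)) (0∷-⊕ (shift i p) (shift i q))

  ⋆-shift : ∀ i x p → x ⋆ shift i p ≋ shift i (x ⋆ p)
  ⋆-shift zero    x p = ≋-refl
  ⋆-shift (suc i) x p = ≋-trans (⋆-0∷ x (shift i p)) (∷-cong refl (⋆-shift i x p))

  shift-0∷ : ∀ i p → shift i (0# ∷ p) ≡ shift (suc i) p
  shift-0∷ zero    p = ≡.refl
  shift-0∷ (suc i) p = ≡.cong (0# ∷_) (shift-0∷ i p)

  shift-∷ : ∀ i x p → shift i (x ∷ p) ≋ shift i (const x) ⊕ shift (suc i) p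
  shift-∷ i x p = begin
    shift i (x ∷ p)                          ≈⟨ shift-cong i (∷-cong (+-identityʳ x) ≋-refl) ⟨
    shift i (const x ⊕ (0# ∷ p))             ≈⟨ shift-⊕ i (const x) (0# ∷ p) ⟩
    shift i (const x) ⊕ shift i (0# ∷ p)     ≡⟨ ≡.cong (shift i (const x) ⊕_) (shift-0∷ i p) ⟩
    shift i (const x) ⊕ shift (suc i) p      ∎
    where open ≋-Reasoning

  E₂^≡shift : ∀ i → E₂^ i ≡ shift i (const 1#)
  E₂^≡shift zero    = ≡.refl
  E₂^≡shift (suc i) = ≡.cong (0# ∷_) (E₂^≡shift i)

  E₂^-⊗ : ∀ i q → E₂^ i ⊗ q ≋ shift i q
  E₂^-⊗ zero    q = ⊗-identityˡ q
  E₂^-⊗ (suc i) q = ≋-trans (0∷-⊗ (E₂^ i) q) (∷-cong refl (E₂^-⊗ i q))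

  ⊗-E₂^ : ∀ i q → q ⊗ E₂^ i ≋ shift i q
  ⊗-E₂^ i []      = ≋-sym (shift-[] i)
  ⊗-E₂^ i (y ∷ q) = begin
    y ⋆ E₂^ i ⊕ (0# ∷ q ⊗ E₂^ i)
      ≡⟨ ≡.cong (λ e → y ⋆ e ⊕ (0# ∷ q ⊗ E₂^ i)) (E₂^≡shift i) ⟩
    y ⋆ shift i (const 1#) ⊕ (0# ∷ q ⊗ E₂^ i)
      ≈⟨ ⊕-cong (⋆-shift i y (const 1#)) (∷-cong refl (⊗-E₂^ i q)) ⟩
    shift i (y ⋆ const 1#) ⊕ shift (suc i) q
      ≈⟨ ⊕-congʳ (shift (suc i) q) (shift-cong i (∷-cong (*-identityʳ y) ≋-refl)) ⟩
    shift i (const y) ⊕ shift (suc i) q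
      ≈⟨ shift-∷ i y q ⟨
    shift i (y ∷ q)
      ∎
    where open ≋-Reasoning

  Δ-shift-const : ∀ i x → Δ (shift (suc i) (const x)) ≋ natK (suc i) · shift i (const x)
  Δ-shift-const zero    x = ∷-cong (trans (+-identityʳ x) (sym (trans (*-congʳ ι-natK-1) (*-identityˡ x)))) 0∷[]≋[]
  Δ-shift-const (suc i) x = begin
    shift (suc i) (const x) ⊕ (0# ∷ Δ (shift (suc i) (const x)))
      ≈⟨ ⊕-cong (≋-sym (·-identityˡ (shift (suc i) (const x))))
                (≋-trans (∷-cong refl (Δ-shift-const i x)) (≋-sym (⋆-0∷ _ _))) ⟩
    K.1# · shift (suc i) (const x) ⊕ natK (suc i) · shift (suc i) (const x)
      ≈⟨ ·-distribʳ K.1# (natK (suc i)) _ ⟨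
    natK (suc (suc i)) · shift (suc i) (const x)
      ∎
    where open ≋-Reasoning

  -- Closed form of 𝒟

  raise : ℕ → ℤ
  raise i = ℤ.+ (2 ℕ.* N ℕ.* i)

  -- For c ∈ M_{a/N−2i}, 𝒟(c E₂ⁱ) has E₂ⁱ⁺¹-coefficient (a/N − 2i) c from 𝒟c plus i c from 𝒟(E₂ⁱ).
  W : ℤ → ℕ → K.Carrier
  W a i = deg (a ℤ.- raise i) K.+ natK i

  weigh : ℤ → ℕ → Poly → Poly
  weigh a i []      = []
  weigh a i (x ∷ p) = ι (W a i) * x ∷ weigh a (suc i) p

  coeff-weigh : ∀ a i p j → coeff (weigh a i p) j ≈ ι (W a (i ℕ.+ j)) * coeff p j
  coeff-weigh a i []      j       = sym (zeroʳ _)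
  coeff-weigh a i (x ∷ p) zero    = *-congʳ (ι-cong (K.reflexive (≡.cong (W a) (≡.sym (ℕP.+-identityʳ i)))))
  coeff-weigh a i (x ∷ p) (suc j) =
    trans (coeff-weigh a (suc i) p j) (*-congʳ (ι-cong (K.reflexive (≡.cong (W a) (≡.sym (ℕP.+-suc i j))))))

  𝒟′ : ℤ → Poly → Poly
  𝒟′ a p = map ∂ p ⊕ (0# ∷ weigh a 0 p) ⊕ E₄ ⋆ Δ p

  𝒟-term : ℤ → ℕ → Carrier → Poly
  𝒟-term a i x = (((∂ x ∷ []) ⊕ (deg (a ℤ.- raise i) · (0# ∷ x ∷ []))) ⊗ E₂^ i) ⊕ (const x ⊗ 𝒟E₂^ i)

  𝒟-term≋ : ∀ a i x → 𝒟-term a i x ≋ shift i (∂ x ∷ ι (W a i) * x ∷ []) ⊕ E₄ ⋆ Δ (shift i (const x))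
  𝒟-term≋ a zero    x = begin
    𝒟-term a 0 x                                   ≈⟨ ⊕-cong (⊗-identityʳ L) (⊗-zeroʳ (const x)) ⟩
    L ⊕ []                                         ≈⟨ ⊕-identityʳ L ⟩
    L                                              ≈⟨ ∷-cong (trans (+-congˡ (zeroʳ _)) (+-identityʳ _)) (∷-cong W₀ ≋-refl) ⟩
    (∂ x ∷ ι (W a 0) * x ∷ [])                     ≈⟨ ⊕-identityʳ _ ⟨
    (∂ x ∷ ι (W a 0) * x ∷ []) ⊕ []                ≈⟨ ⊕-congˡ (∂ x ∷ ι (W a 0) * x ∷ []) (⋆-cong refl (Δ-const x)) ⟨
    (∂ x ∷ ι (W a 0) * x ∷ []) ⊕ E₄ ⋆ Δ (const x)  ∎
    where
    open ≋-Reasoning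
    L = (∂ x ∷ []) ⊕ (deg (a ℤ.- raise 0) · (0# ∷ x ∷ []))
    W₀ : ι (deg (a ℤ.- raise 0)) * x ≈ ι (W a 0) * x
    W₀ = *-congʳ (ι-cong (K.sym (K.+-identityʳ _)))
  𝒟-term≋ a (suc s) x = begin
    𝒟-term a (suc s) x
      ≈⟨ ⊕-cong (⊗-E₂^ (suc s) L) (≋-trans (const-⊗ x _) (⋆-cong refl (⋆-cong refl (E₂^-⊗ s 𝒟E₂)))) ⟩
    shift (suc s) L ⊕ x ⋆ n · shift s 𝒟E₂
      ≈⟨ ⊕-congˡ (shift (suc s) L) (≋-trans (⋆-cong refl (⋆-shift s (ι n) 𝒟E₂)) (⋆-shift s x _)) ⟩
    shift (suc s) L ⊕ shift s (x ⋆ n · 𝒟E₂)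
      ≡⟨ ≡.cong (_⊕ shift s (x ⋆ n · 𝒟E₂)) (shift-0∷ s L) ⟨
    shift s (0# ∷ L) ⊕ shift s (x ⋆ n · 𝒟E₂)
      ≈⟨ ≋-trans (≋-sym (shift-⊕ s _ _)) (≋-trans (shift-cong s inner) (shift-⊕ s _ _)) ⟩
    shift s (0# ∷ R) ⊕ shift s (E₄ ⋆ n · const x)
      ≡⟨ ≡.cong (_⊕ shift s (E₄ ⋆ n · const x)) (shift-0∷ s R) ⟩
    shift (suc s) R ⊕ shift s (E₄ ⋆ n · const x)
      ≈⟨ ⊕-congˡ (shift (suc s) R) (≋-trans (⋆-cong refl (⋆-shift s (ι n) (const x))) (⋆-shift s E₄ _)) ⟨
    shift (suc s) R ⊕ E₄ ⋆ n · shift s (const x)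
      ≈⟨ ⊕-congˡ (shift (suc s) R) (⋆-cong refl (Δ-shift-const s x)) ⟨
    shift (suc s) R ⊕ E₄ ⋆ Δ (shift (suc s) (const x))
      ∎
    where
    open ≋-Reasoning
    d = deg (a ℤ.- raise (suc s))
    n = natK (suc s)
    L = (∂ x ∷ []) ⊕ (d · (0# ∷ x ∷ []))
    R = ∂ x ∷ ι (W a (suc s)) * x ∷ []
    inner : (0# ∷ L) ⊕ x ⋆ n · 𝒟E₂ ≋ (0# ∷ R) ⊕ E₄ ⋆ n · const x
    inner = ∷-cong coeff₀ (∷-cong coeff₁ (∷-cong coeff₂ ≋-refl))
      where
      coeff₀ : 0# + x * (ι n * E₄) ≈ 0# + E₄ * (ι n * x)
      coeff₀ = +-congˡ (MS.solve 3 (λ x n e → x :* (n :* e) := e :* (n :* x)) refl x (ι n) E₄)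
        where open MS using (_:*_; _:=_)
      coeff₁ : ∂ x + ι d * 0# + x * (ι n * 0#) ≈ ∂ x
      coeff₁ = trans (+-cong (trans (+-congˡ (zeroʳ _)) (+-identityʳ _)) (trans (*-congˡ (zeroʳ _)) (zeroʳ _))) (+-identityʳ _)
      coeff₂ : ι d * x + x * (ι n * 1#) ≈ ι (W a (suc s)) * x
      coeff₂ = trans (+-congˡ (trans (*-congˡ (*-identityʳ _)) (*-comm x (ι n))))
                     (trans (sym (distribʳ x (ι d) (ι n))) (*-congʳ (sym (ι-+ d n))))

  𝒟-from≋ : ∀ a i p → 𝒟-from a i p ≋ shift i (map ∂ p ⊕ (0# ∷ weigh a i p)) ⊕ E₄ ⋆ Δ (shift i p)
  𝒟-from≋ a i []      = ≋-sym (⊕-cong (≋-trans (shift-cong i 0∷[]≋[]) (shift-[] i)) (⋆-cong refl (Δ-cong (shift-[] i))))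
  𝒟-from≋ a i (x ∷ p) = begin
    𝒟-term a i x ⊕ 𝒟-from a (suc i) p
      ≈⟨ ⊕-cong (𝒟-term≋ a i x) (𝒟-from≋ a (suc i) p) ⟩
    (S ⊕ E₄ ⋆ Δ (shift i (const x))) ⊕ (P ⊕ E₄ ⋆ Δ (shift (suc i) p))
      ≈⟨ ⊕-interchange S _ P _ ⟩
    (S ⊕ P) ⊕ (E₄ ⋆ Δ (shift i (const x)) ⊕ E₄ ⋆ Δ (shift (suc i) p))
      ≈⟨ ⊕-cong head (≋-trans (⋆-cong refl (Δ-⊕ (shift i (const x)) (shift (suc i) p)))
                              (⋆-distribˡ E₄ (Δ (shift i (const x))) (Δ (shift (suc i) p)))) ⟨
    shift i (rest ⊕ weighted) ⊕ E₄ ⋆ Δ (shift i (const x) ⊕ shift (suc i) p)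
      ≈⟨ ⊕-congˡ (shift i (rest ⊕ weighted)) (⋆-cong refl (Δ-cong (shift-∷ i x p))) ⟨
    shift i (rest ⊕ weighted) ⊕ E₄ ⋆ Δ (shift i (x ∷ p))
      ∎
    where
    open ≋-Reasoning
    S = shift i (∂ x ∷ ι (W a i) * x ∷ [])
    P = shift (suc i) (map ∂ p ⊕ (0# ∷ weigh a (suc i) p))
    rest = map ∂ (x ∷ p)
    weighted = 0# ∷ weigh a i (x ∷ p)
    head : shift i (rest ⊕ weighted) ≋ S ⊕ P
    head = begin
      shift i (rest ⊕ weighted)                    ≈⟨ shift-cong i (⊕-split₂ (∂ x) (ι (W a i) * x) (map ∂ p) (weigh a (suc i) p)) ⟩
      shift i ((∂ x ∷ ι (W a i) * x ∷ []) ⊕ (0# ∷ (map ∂ p ⊕ (0# ∷ weigh a (suc i) p))))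
                                                   ≈⟨ shift-⊕ i _ _ ⟩
      S ⊕ shift i (0# ∷ (map ∂ p ⊕ (0# ∷ weigh a (suc i) p)))
                                                   ≡⟨ ≡.cong (S ⊕_) (shift-0∷ i _) ⟩
      S ⊕ P                                        ∎

  𝒟≋𝒟′ : ∀ a p → 𝒟 a p ≋ 𝒟′ a p
  𝒟≋𝒟′ a = 𝒟-from≋ a 0

  [a-b]+b≡a : ∀ a b → (a ℤ.- b) ℤ.+ b ≡ a
  [a-b]+b≡a = ℤSolver.solve 2 (λ a b → (a :- b) :+ b := a) ≡.refl
    where open ℤSolver using (_:+_; _:-_; _:=_)

  a+raise0≡a : ∀ a → a ℤ.+ raise 0 ≡ a
  a+raise0≡a a = ≡.trans (≡.cong (λ k → a ℤ.+ ℤ.+ k) (ℕP.*-zeroʳ (2 ℕ.* N))) (ℤP.+-identityʳ a)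

  raise-suc : ∀ i → raise (suc i) ≡ two ℤ.+ raise i
  raise-suc i = ≡.trans (≡.cong ℤ.+_ (ℕP.*-suc (2 ℕ.* N) i)) (ℤP.pos-+ (2 ℕ.* N) (2 ℕ.* N ℕ.* i))

  [a-two]-raise≡a-raise-suc : ∀ a i → (a ℤ.- two) ℤ.- raise i ≡ a ℤ.- raise (suc i)
  [a-two]-raise≡a-raise-suc a i = ≡.trans
    (ℤSolver.solve 3 (λ a t r → (a :- t) :- r := a :- (t :+ r)) ≡.refl a two (raise i))
    (≡.cong (λ r → a ℤ.- r) (≡.sym (raise-suc i)))
    where open ℤSolver using (_:+_; _:-_; _:=_)

  [a+raise-suc]-two≡a+raise : ∀ a i → (a ℤ.+ raise (suc i)) ℤ.- two ≡ a ℤ.+ raise i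
  [a+raise-suc]-two≡a+raise a i = ≡.trans
    (≡.cong (λ r → (a ℤ.+ r) ℤ.- two) (raise-suc i))
    (ℤSolver.solve 3 (λ a t r → (a :+ (t :+ r)) :- t := a :+ r) ≡.refl a two (raise i))
    where open ℤSolver using (_:+_; _:-_; _:=_)

  four≡two+two : ℤ.+ (4 ℕ.* N) ≡ two ℤ.+ two
  four≡two+two = ≡.trans (≡.cong ℤ.+_ (ℕP.*-distribʳ-+ N 2 2)) (ℤP.pos-+ (2 ℕ.* N) (2 ℕ.* N))

  invNat-natK : ∀ n .{{_ : NonZero n}} → invNat n K.* natK n K.≈ K.1#
  invNat-natK (suc n) = K.inv-l _ _

  natK-*N/N : ∀ k → natK (k ℕ.* N) K.* invNat N K.≈ natK k
  natK-*N/N k = begin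
    natK (k ℕ.* N) K.* invNat N         ≈⟨ K.*-congʳ (natR-* K.commutativeRing k N) ⟩
    (natK k K.* natK N) K.* invNat N    ≈⟨ K.*-assoc _ _ _ ⟩
    natK k K.* (natK N K.* invNat N)    ≈⟨ K.*-congˡ (K.trans (K.*-comm _ _) (invNat-natK N)) ⟩
    natK k K.* K.1#                     ≈⟨ K.*-identityʳ _ ⟩
    natK k                              ∎
    where open SetoidReasoning K.setoid

  deg-two : deg two K.≈ natK 2
  deg-two = natK-*N/N 2

  deg-raise : ∀ i → deg (raise i) K.≈ natK i K.+ natK i
  deg-raise i = begin
    natK (2 ℕ.* N ℕ.* i) K.* invNat N    ≡⟨ ≡.cong (λ k → natK k K.* invNat N) 2Ni≡[i+i]N ⟩
    natK ((i ℕ.+ i) ℕ.* N) K.* invNat N  ≈⟨ natK-*N/N (i ℕ.+ i) ⟩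
    natK (i ℕ.+ i)                       ≈⟨ natR-+ K.commutativeRing i i ⟩
    natK i K.+ natK i                    ∎
    where
    open SetoidReasoning K.setoid
    2Ni≡[i+i]N : 2 ℕ.* N ℕ.* i ≡ (i ℕ.+ i) ℕ.* N
    2Ni≡[i+i]N = ℕSolver.solve 2 (λ n i → con 2 :* n :* i := (i :+ i) :* n) ≡.refl N i
      where open ℕSolver using (_:+_; _:*_; _:=_; con)

  deg-+raise : ∀ a i → deg (a ℤ.+ raise i) K.≈ deg a K.+ (natK i K.+ natK i)
  deg-+raise a i = K.trans (K.*-congʳ (intR-+natR K.commutativeRing a _))
                           (K.trans (K.distribʳ _ _ _) (K.+-congˡ (deg-raise i)))

  deg-−raise : ∀ a i → deg (a ℤ.- raise i) K.+ (natK i K.+ natK i) K.≈ deg a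
  deg-−raise a i = K.trans (K.sym (deg-+raise (a ℤ.- raise i) i)) (K.reflexive (≡.cong deg ([a-b]+b≡a a (raise i))))

  -- The commutator [Δ, 𝒟]

  W-commutator₀ : ∀ a → natK 1 K.* W a 0 K.≈ deg a
  W-commutator₀ a = K.trans
    (KS.solve 1 (λ u → (con 1 :+ con 0) :* (u :+ con 0) := u :+ (con 0 :+ con 0)) K.refl (deg (a ℤ.- raise 0)))
    (deg-−raise a 0)
    where open KS using (_:+_; _:*_; _:=_; con)

  W-commutator : ∀ a t → natK (suc (suc t)) K.* W a (suc t) K.≈ W (a ℤ.- two) t K.* natK (suc t) K.+ deg a
  W-commutator a t = begin
    natK (suc (suc t)) K.* (u K.+ natK (suc t))
      ≈⟨ KS.solve 2 (λ u t → (con 1 :+ (con 1 :+ t)) :* (u :+ (con 1 :+ t))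
                            := (u :+ t) :* (con 1 :+ t) :+ (u :+ ((con 1 :+ t) :+ (con 1 :+ t)))) K.refl u (natK t) ⟩
    (u K.+ natK t) K.* natK (suc t) K.+ (u K.+ (natK (suc t) K.+ natK (suc t)))
      ≈⟨ K.+-cong (K.*-congʳ (K.+-congʳ (K.reflexive (≡.cong deg (≡.sym ([a-two]-raise≡a-raise-suc a t))))))
                  (deg-−raise a (suc t)) ⟩
    W (a ℤ.- two) t K.* natK (suc t) K.+ deg a
      ∎
    where
    open SetoidReasoning K.setoid
    open KS using (_:+_; _:*_; _:=_; con)
    u = deg (a ℤ.- raise (suc t))

  ι-*-assoc : ∀ k l x → ι k * (ι l * x) ≈ ι (k K.* l) * x
  ι-*-assoc k l x = trans (sym (*-assoc _ _ _)) (*-congʳ (sym (ι-* k l)))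

  weigh-commutator : ∀ a p j → ι (natK (suc j)) * coeff (weigh a 0 p) j
                               ≈ coeff (0# ∷ weigh (a ℤ.- two) 0 (Δ p)) j + ι (deg a) * coeff p j
  weigh-commutator a p zero = begin
    ι (natK 1) * coeff (weigh a 0 p) 0      ≈⟨ *-congˡ (coeff-weigh a 0 p 0) ⟩
    ι (natK 1) * (ι (W a 0) * coeff p 0)    ≈⟨ ι-*-assoc _ _ _ ⟩
    ι (natK 1 K.* W a 0) * coeff p 0        ≈⟨ *-congʳ (ι-cong (W-commutator₀ a)) ⟩
    ι (deg a) * coeff p 0                   ≈⟨ +-identityˡ _ ⟨
    0# + ι (deg a) * coeff p 0              ∎
    where open SetoidReasoning setoid
  weigh-commutator a p (suc t) = begin
    ι (natK (suc (suc t))) * coeff (weigh a 0 p) (suc t)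
      ≈⟨ trans (*-congˡ (coeff-weigh a 0 p (suc t))) (ι-*-assoc _ _ _) ⟩
    ι (natK (suc (suc t)) K.* W a (suc t)) * c
      ≈⟨ *-congʳ (ι-cong (W-commutator a t)) ⟩
    ι (W b t K.* natK (suc t) K.+ deg a) * c
      ≈⟨ trans (*-congʳ (ι-+ _ _)) (distribʳ c _ _) ⟩
    ι (W b t K.* natK (suc t)) * c + ι (deg a) * c
      ≈⟨ +-congʳ (ι-*-assoc _ _ _) ⟨
    ι (W b t) * (ι (natK (suc t)) * c) + ι (deg a) * c
      ≈⟨ +-congʳ (trans (coeff-weigh b 0 (Δ p) t) (*-congˡ (coeff-Δ p t))) ⟨
    coeff (weigh b 0 (Δ p)) t + ι (deg a) * c
      ∎
    where
    open SetoidReasoning setoid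
    b = a ℤ.- two
    c = coeff p (suc t)

  ∂-0 : ∂ 0# ≈ 0#
  ∂-0 = x+x≈x⇒x≈0 (∂ 0#) (trans (sym (∂-+ 0# 0#)) (∂-cong (+-identityʳ 0#)))
    where open RingProperties ring using (x+x≈x⇒x≈0)

  coeff-map-∂ : ∀ p j → coeff (map ∂ p) j ≈ ∂ (coeff p j)
  coeff-map-∂ []      j       = sym ∂-0
  coeff-map-∂ (x ∷ p) zero    = refl
  coeff-map-∂ (x ∷ p) (suc j) = coeff-map-∂ p j

  coeff-𝒟′ : ∀ a p j → coeff (𝒟′ a p) j ≈ ∂ (coeff p j) + coeff (0# ∷ weigh a 0 p) j + E₄ * coeff (Δ p) j
  coeff-𝒟′ a p j = trans (coeff-⊕ (map ∂ p ⊕ (0# ∷ weigh a 0 p)) (E₄ ⋆ Δ p) j)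
    (+-cong (trans (coeff-⊕ (map ∂ p) (0# ∷ weigh a 0 p) j) (+-congʳ (coeff-map-∂ p j))) (coeff-⋆ E₄ (Δ p) j))

  Δ-𝒟′ : ∀ a p → Δ (𝒟′ a p) ≋ 𝒟′ (a ℤ.- two) (Δ p) ⊕ deg a · p
  Δ-𝒟′ a p = coeffwise pointwise
    where
    open SetoidReasoning setoid
    b = a ℤ.- two
    pointwise : ∀ j → coeff (Δ (𝒟′ a p)) j ≈ coeff (𝒟′ b (Δ p) ⊕ deg a · p) j
    pointwise j = begin
      coeff (Δ (𝒟′ a p)) j
        ≈⟨ trans (coeff-Δ (𝒟′ a p) j) (*-congˡ (coeff-𝒟′ a p (suc j))) ⟩
      n * (∂ (coeff p (suc j)) + coeff (weigh a 0 p) j + E₄ * coeff (Δ p) (suc j))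
        ≈⟨ MS.solve 5 (λ n x y e z → n :* (x :+ y :+ e :* z) := n :* x :+ n :* y :+ e :* (n :* z)) refl n _ _ E₄ _ ⟩
      n * ∂ (coeff p (suc j)) + n * coeff (weigh a 0 p) j + E₄ * (n * coeff (Δ p) (suc j))
        ≈⟨ +-cong (+-cong (trans (sym (∂-ι* _ _)) (∂-cong (sym (coeff-Δ p j)))) (weigh-commutator a p j))
                  (*-congˡ (sym (coeff-Δ (Δ p) j))) ⟩
      ∂ (coeff (Δ p) j) + (coeff (0# ∷ weigh b 0 (Δ p)) j + ι (deg a) * coeff p j) + E₄ * coeff (Δ (Δ p)) j
        ≈⟨ MS.solve 4 (λ x y z e → x :+ (y :+ z) :+ e := x :+ y :+ e :+ z) refl _ _ _ _ ⟩
      ∂ (coeff (Δ p) j) + coeff (0# ∷ weigh b 0 (Δ p)) j + E₄ * coeff (Δ (Δ p)) j + ι (deg a) * coeff p j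
        ≈⟨ trans (coeff-⊕ (𝒟′ b (Δ p)) (deg a · p) j) (+-cong (coeff-𝒟′ b (Δ p) j) (coeff-· (deg a) p j)) ⟨
      coeff (𝒟′ b (Δ p) ⊕ deg a · p) j
        ∎
      where
      open MS using (_:+_; _:*_; _:=_)
      n = ι (natK (suc j))

  map-∂-cong : ∀ {p q} → p ≋ q → map ∂ p ≋ map ∂ q
  map-∂-cong {p} {q} e = coeffwise λ j → trans (coeff-map-∂ p j) (trans (∂-cong (at e j)) (sym (coeff-map-∂ q j)))

  weigh-cong : ∀ a i {p q} → p ≋ q → weigh a i p ≋ weigh a i q
  weigh-cong a i {p} {q} e = coeffwise λ j → trans (coeff-weigh a i p j) (trans (*-congˡ (at e j)) (sym (coeff-weigh a i q j)))

  map-∂-· : ∀ l p → map ∂ (l · p) ≋ l · map ∂ p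
  map-∂-· l p = coeffwise λ j → begin
    coeff (map ∂ (l · p)) j  ≈⟨ trans (coeff-map-∂ (l · p) j) (∂-cong (coeff-· l p j)) ⟩
    ∂ (ι l * coeff p j)      ≈⟨ ∂-ι* l _ ⟩
    ι l * ∂ (coeff p j)      ≈⟨ trans (coeff-· l (map ∂ p) j) (*-congˡ (coeff-map-∂ p j)) ⟨
    coeff (l · map ∂ p) j    ∎
    where open SetoidReasoning setoid

  weigh-· : ∀ a i l p → weigh a i (l · p) ≋ l · weigh a i p
  weigh-· a i l p = coeffwise λ j → begin
    coeff (weigh a i (l · p)) j            ≈⟨ trans (coeff-weigh a i (l · p) j) (*-congˡ (coeff-· l p j)) ⟩
    ι (W a (i ℕ.+ j)) * (ι l * coeff p j)  ≈⟨ x∙yz≈y∙xz _ _ _ ⟩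
    ι l * (ι (W a (i ℕ.+ j)) * coeff p j)  ≈⟨ trans (coeff-· l (weigh a i p) j) (*-congˡ (coeff-weigh a i p j)) ⟨
    coeff (l · weigh a i p) j              ∎
    where open SetoidReasoning setoid
          open import Algebra.Properties.CommutativeSemigroup *-commutativeSemigroup using (x∙yz≈y∙xz)

  𝒟-cong : ∀ a {p q} → p ≋ q → 𝒟 a p ≋ 𝒟 a q
  𝒟-cong a {p} {q} e = begin
    𝒟 a p   ≈⟨ 𝒟≋𝒟′ a p ⟩
    𝒟′ a p  ≈⟨ ⊕-cong (⊕-cong (map-∂-cong e) (∷-cong refl (weigh-cong a 0 e))) (⋆-cong refl (Δ-cong e)) ⟩
    𝒟′ a q  ≈⟨ 𝒟≋𝒟′ a q ⟨
    𝒟 a q   ∎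
    where open ≋-Reasoning

  𝒟-· : ∀ a l p → 𝒟 a (l · p) ≋ l · 𝒟 a p
  𝒟-· a l p = begin
    𝒟 a (l · p)
      ≈⟨ 𝒟≋𝒟′ a (l · p) ⟩
    map ∂ (l · p) ⊕ (0# ∷ weigh a 0 (l · p)) ⊕ E₄ ⋆ Δ (l · p)
      ≈⟨ ⊕-cong (⊕-cong (map-∂-· l p) (≋-trans (∷-cong refl (weigh-· a 0 l p)) (≋-sym (⋆-0∷ (ι l) (weigh a 0 p)))))
                (≋-trans (⋆-cong refl (Δ-⋆ (ι l) p)) (⋆-comm E₄ (ι l) (Δ p))) ⟩
    l · map ∂ p ⊕ l · (0# ∷ weigh a 0 p) ⊕ l · E₄ ⋆ Δ p
      ≈⟨ ⊕-congʳ (l · E₄ ⋆ Δ p) (⋆-distribˡ (ι l) (map ∂ p) (0# ∷ weigh a 0 p)) ⟨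
    l · (map ∂ p ⊕ (0# ∷ weigh a 0 p)) ⊕ l · E₄ ⋆ Δ p
      ≈⟨ ⋆-distribˡ (ι l) (map ∂ p ⊕ (0# ∷ weigh a 0 p)) (E₄ ⋆ Δ p) ⟨
    l · 𝒟′ a p
      ≈⟨ ⋆-cong refl (𝒟≋𝒟′ a p) ⟨
    l · 𝒟 a p
      ∎
    where open ≋-Reasoning

  Δ-𝒟 : ∀ a p → Δ (𝒟 a p) ≋ 𝒟 (a ℤ.- two) (Δ p) ⊕ deg a · p
  Δ-𝒟 a p = begin
    Δ (𝒟 a p)                               ≈⟨ Δ-cong (𝒟≋𝒟′ a p) ⟩
    Δ (𝒟′ a p)                              ≈⟨ Δ-𝒟′ a p ⟩
    𝒟′ (a ℤ.- two) (Δ p) ⊕ deg a · p        ≈⟨ ⊕-congʳ (deg a · p) (𝒟≋𝒟′ (a ℤ.- two) (Δ p)) ⟨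
    𝒟 (a ℤ.- two) (Δ p) ⊕ deg a · p         ∎
    where open ≋-Reasoning

  -- Lowest-weight vectors

  γ : K.Carrier → ℕ → K.Carrier
  γ κ m = natK (suc m) K.* (κ K.+ natK m)

  Δ-𝒟^ : ∀ a F → Δ (𝒟 a F) ≋ deg a · F → ∀ m → Δ (𝒟^ (suc m) a F) ≋ γ (deg a) m · 𝒟^ m a F
  Δ-𝒟^ a F lowest zero = begin
    Δ (𝒟 (a ℤ.+ raise 0) F)  ≡⟨ ≡.cong (λ b → Δ (𝒟 b F)) (a+raise0≡a a) ⟩
    Δ (𝒟 a F)                ≈⟨ lowest ⟩
    deg a · F                ≈⟨ ·-cong (KS.solve 1 (λ κ → κ := (con 1 :+ con 0) :* (κ :+ con 0)) K.refl (deg a)) ≋-refl ⟩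
    γ (deg a) 0 · F          ∎
    where open ≋-Reasoning
          open KS using (_:+_; _:*_; _:=_; con)
  Δ-𝒟^ a F lowest (suc m) = begin
    Δ (𝒟 b P)                                 ≈⟨ Δ-𝒟 b P ⟩
    𝒟 (b ℤ.- two) (Δ P) ⊕ deg b · P
      ≈⟨ ⊕-congʳ (deg b · P) (≋-trans (𝒟-cong (b ℤ.- two) (Δ-𝒟^ a F lowest m)) (𝒟-· (b ℤ.- two) _ Q)) ⟩
    γ κ m · 𝒟 (b ℤ.- two) Q ⊕ deg b · P
      ≡⟨ ≡.cong (λ b′ → γ κ m · 𝒟 b′ Q ⊕ deg b · P) ([a+raise-suc]-two≡a+raise a m) ⟩
    γ κ m · P ⊕ deg b · P                     ≈⟨ ·-distribʳ (γ κ m) (deg b) P ⟨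
    (γ κ m K.+ deg b) · P                     ≈⟨ ·-cong γ-suc ≋-refl ⟩
    γ κ (suc m) · P                           ∎
    where
    open ≋-Reasoning
    κ = deg a
    b = a ℤ.+ raise (suc m)
    Q = 𝒟^ m a F
    P = 𝒟^ (suc m) a F
    γ-suc : γ κ m K.+ deg b K.≈ γ κ (suc m)
    γ-suc = K.trans (K.+-congˡ (deg-+raise a (suc m)))
      (KS.solve 2 (λ κ t → (con 1 :+ t) :* (κ :+ t) :+ (κ :+ ((con 1 :+ t) :+ (con 1 :+ t)))
                         := (con 1 :+ (con 1 :+ t)) :* (κ :+ (con 1 :+ t))) K.refl κ (natK m))
      where open KS using (_:+_; _:*_; _:=_; con)

  Δ-𝒟-const : ∀ a f → Δ (𝒟 a (const f)) ≋ deg a · const f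
  Δ-𝒟-const a f = ≋-trans (Δ-𝒟 a (const f)) (⊕-congʳ (deg a · const f) (𝒟-cong (a ℤ.- two) (Δ-const f)))

  ∂-1 : ∂ 1# ≈ 0#
  ∂-1 = x+x≈x⇒x≈0 (∂ 1#) (begin
    ∂ 1# + ∂ 1#            ≈⟨ +-cong (*-identityʳ _) (*-identityˡ _) ⟨
    ∂ 1# * 1# + 1# * ∂ 1#  ≈⟨ ∂-* 1# 1# ⟨
    ∂ (1# * 1#)            ≈⟨ ∂-cong (*-identityˡ 1#) ⟩
    ∂ 1#                   ∎)
    where open RingProperties ring using (x+x≈x⇒x≈0)
          open SetoidReasoning setoid

  𝒟-1 : 𝒟 (two ℤ.- two) (const 1#) ≋ []
  𝒟-1 = ≋-trans (𝒟≋𝒟′ (two ℤ.- two) (const 1#)) (⊕-cong (⊕-cong ∂-part weight-part) (⋆-cong refl (Δ-const 1#)))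
    where
    ∂-part : (∂ 1# ∷ []) ≋ []
    ∂-part = ≋-trans (∷-cong ∂-1 ≋-refl) 0∷[]≋[]
    [two-two]-raise0≡0 : (two ℤ.- two) ℤ.- raise 0 ≡ ℤ.+ 0
    [two-two]-raise0≡0 = ≡.trans (≡.cong (λ k → (two ℤ.- two) ℤ.- ℤ.+ k) (ℕP.*-zeroʳ (2 ℕ.* N)))
      (ℤSolver.solve 1 (λ t → (t :- t) :- con (ℤ.+ 0) := con (ℤ.+ 0)) ≡.refl two)
      where open ℤSolver using (_:-_; _:=_; con)
    W≈0 : W (two ℤ.- two) 0 K.≈ K.0#
    W≈0 = K.trans (K.+-cong (K.reflexive (≡.cong deg [two-two]-raise0≡0)) K.refl)
                  (K.trans (K.+-identityʳ _) (K.zeroˡ (invNat N)))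
    weight-part : (0# ∷ ι (W (two ℤ.- two) 0) * 1# ∷ []) ≋ []
    weight-part = ≋-trans (∷-cong refl (≋-trans (∷-cong (trans (*-identityʳ _) (trans (ι-cong W≈0) ι-0)) ≋-refl) 0∷[]≋[]))
                          0∷[]≋[]

  Δ-𝒟-E₂ : Δ (𝒟 two E₂) ≋ deg two · E₂
  Δ-𝒟-E₂ = ≋-trans (Δ-𝒟 two E₂) (⊕-congʳ (deg two · E₂) (≋-trans (𝒟-cong (two ℤ.- two) Δ-E₂) 𝒟-1))

  β : K.Carrier → K.Carrier → ℕ → ℕ → K.Carrier
  β A B j m = sgn j K.* rising (A K.+ natK j) m K.* rising (B K.+ natK m) j K.* invNat (j ! ℕ.* m !)

  bracket-term : ℤ → Poly → ℤ → Poly → ℕ → ℕ → Poly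
  bracket-term a F b G n j = β (deg a) (deg b) j (n ℕ.∸ j) · (𝒟^ j a F ⊗ 𝒟^ (n ℕ.∸ j) b G)

  bracket≡sum : ∀ a F b G n → bracket a F b G n ≡ sumP (applyUpTo (bracket-term a F b G n) (suc n))
  bracket≡sum a F b G n = ≡.cong sumP (ListP.map-upTo (bracket-term a F b G n) (suc n))

  rising-cong : ∀ {x y} n → x K.≈ y → rising x n K.≈ rising y n
  rising-cong zero    e = K.refl
  rising-cong (suc n) e = K.*-cong (rising-cong n e) (K.+-congʳ e)

  rising-suc : ∀ x n → rising x (suc n) K.≈ x K.* rising (x K.+ K.1#) n
  rising-suc x zero    = KS.solve 1 (λ x → con 1 :* (x :+ con 0) := x :* con 1) K.refl x
    where open KS using (_:+_; _:*_; _:=_; con)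
  rising-suc x (suc n) = begin
    rising x (suc n) K.* (x K.+ natK (suc n))                         ≈⟨ K.*-congʳ (rising-suc x n) ⟩
    (x K.* rising (x K.+ K.1#) n) K.* (x K.+ natK (suc n))
      ≈⟨ KS.solve 3 (λ x r t → (x :* r) :* (x :+ (con 1 :+ t)) := x :* (r :* ((x :+ con 1) :+ t))) K.refl x _ (natK n) ⟩
    x K.* (rising (x K.+ K.1#) n K.* ((x K.+ K.1#) K.+ natK n))     ∎
    where open SetoidReasoning K.setoid
          open KS using (_:+_; _:*_; _:=_; con)

  rising-+natK-suc : ∀ x t n → rising (x K.+ natK t) (suc n) K.≈ (x K.+ natK t) K.* rising (x K.+ natK (suc t)) n
  rising-+natK-suc x t n = K.trans (rising-suc (x K.+ natK t) n)
    (K.*-congˡ (rising-cong n (KS.solve 2 (λ x t → (x :+ t) :+ con 1 := x :+ (con 1 :+ t)) K.refl x (natK t))))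
    where open KS using (_:+_; _:=_; con)

  natK-*-invNat : ∀ p q .{{_ : NonZero p}} .{{_ : NonZero q}} → natK p K.* invNat (p ℕ.* q) K.≈ invNat q
  natK-*-invNat p q = begin
    natK p K.* x                                 ≈⟨ K.*-identityʳ _ ⟨
    natK p K.* x K.* K.1#                        ≈⟨ K.*-congˡ (K.trans (K.*-comm _ _) (invNat-natK q)) ⟨
    natK p K.* x K.* (natK q K.* invNat q)       ≈⟨ KS.solve 4 (λ a x b i → (a :* x) :* (b :* i) := (x :* (a :* b)) :* i)
                                                              K.refl (natK p) x (natK q) (invNat q) ⟩
    x K.* (natK p K.* natK q) K.* invNat q       ≈⟨ K.*-congʳ (K.*-congˡ (natR-* K.commutativeRing p q)) ⟨
    x K.* natK (p ℕ.* q) K.* invNat q            ≈⟨ K.*-congʳ (invNat-natK (p ℕ.* q) {{ℕP.m*n≢0 p q}}) ⟩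
    K.1# K.* invNat q                            ≈⟨ K.*-identityˡ _ ⟩
    invNat q                                     ∎
    where open SetoidReasoning K.setoid
          open KS using (_:*_; _:=_)
          x = invNat (p ℕ.* q)

  m!*[1+n]!≡[1+n]*[m!*n!] : ∀ m n → m ! ℕ.* suc n ! ≡ suc n ℕ.* (m ! ℕ.* n !)
  m!*[1+n]!≡[1+n]*[m!*n!] m n = ℕSolver.solve 3 (λ a s b → a :* (s :* b) := s :* (a :* b)) ≡.refl (m !) (suc n) (n !)
    where open ℕSolver using (_:*_; _:=_)

  -- Consecutive terms of Δ[F,G]_{𝒟,n} cancel.
  β-cancel : ∀ A B j k → β A B (suc j) k K.* γ A j K.+ β A B j (suc k) K.* γ B k K.≈ K.0#
  β-cancel A B j k = begin
    β A B (suc j) k K.* (n₁ K.* P) K.+ β A B j (suc k) K.* (n₂ K.* Q)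
      ≈⟨ K.+-cong (K.*-congʳ (K.*-congʳ (K.*-congˡ (rising-+natK-suc B k j))))
                  (K.*-congʳ (K.*-congʳ (K.*-congʳ (K.*-congˡ (rising-+natK-suc A j k))))) ⟩
    (K.- σ K.* Ra K.* (Q K.* Rb) K.* i₁) K.* (n₁ K.* P) K.+ (σ K.* (P K.* Ra) K.* Rb K.* i₂) K.* (n₂ K.* Q)
      ≈⟨ K.+-cong
           (KS.solve 7 (λ s a q b i n p → (s :* a :* (q :* b) :* i) :* (n :* p) := s :* (a :* q :* b :* p) :* (n :* i))
                       K.refl (K.- σ) Ra Q Rb i₁ n₁ P)
           (KS.solve 7 (λ s a q b i n p → (s :* (p :* a) :* b :* i) :* (n :* q) := s :* (a :* q :* b :* p) :* (n :* i))
                       K.refl σ Ra Q Rb i₂ n₂ P) ⟩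
    K.- σ K.* Z K.* (n₁ K.* i₁) K.+ σ K.* Z K.* (n₂ K.* i₂)
      ≈⟨ K.+-cong (K.*-congˡ n₁i₁≈I) (K.*-congˡ n₂i₂≈I) ⟩
    K.- σ K.* Z K.* I K.+ σ K.* Z K.* I
      ≈⟨ KS.solve 4 (λ a s z i → a :* z :* i :+ s :* z :* i := (a :+ s) :* (z :* i)) K.refl (K.- σ) σ Z I ⟩
    (K.- σ K.+ σ) K.* (Z K.* I)
      ≈⟨ K.trans (K.*-congʳ (K.-‿inverseˡ σ)) (K.zeroˡ _) ⟩
    K.0#
      ∎
    where
    open SetoidReasoning K.setoid
    open KS using (_:+_; _:*_; _:=_)
    σ  = sgn j
    n₁ = natK (suc j)
    n₂ = natK (suc k)
    P  = A K.+ natK j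
    Q  = B K.+ natK k
    Ra = rising (A K.+ natK (suc j)) k
    Rb = rising (B K.+ natK (suc k)) j
    i₁ = invNat (suc j ! ℕ.* k !)
    i₂ = invNat (j ! ℕ.* suc k !)
    I  = invNat (j ! ℕ.* k !)
    Z  = Ra K.* Q K.* Rb K.* P
    n₁i₁≈I : n₁ K.* i₁ K.≈ I
    n₁i₁≈I = K.trans (K.*-congˡ (K.reflexive (≡.cong invNat (ℕP.*-assoc (suc j) (j !) (k !)))))
                     (natK-*-invNat (suc j) (j ! ℕ.* k !) {{_}} {{ℕP._!*_!≢0 j k}})
    n₂i₂≈I : n₂ K.* i₂ K.≈ I
    n₂i₂≈I = K.trans (K.*-congˡ (K.reflexive (≡.cong invNat (m!*[1+n]!≡[1+n]*[m!*n!] j k))))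
                     (natK-*-invNat (suc k) (j ! ℕ.* k !) {{_}} {{ℕP._!*_!≢0 j k}})

  Δ-sumP : ∀ (T : ℕ → Poly) k → Δ (sumP (applyUpTo T k)) ≋ sumP (applyUpTo (λ j → Δ (T j)) k)
  Δ-sumP T zero    = ≋-refl
  Δ-sumP T (suc k) = ≋-trans (Δ-⊕ (T 0) _) (⊕-congˡ (Δ (T 0)) (Δ-sumP (λ j → T (suc j)) k))

  sumP-telescope : ∀ n (T L R : ℕ → Poly) →
                   (∀ j → j ℕ.≤ n → T j ≋ L j ⊕ R j) → (∀ j → j ℕ.< n → L (suc j) ⊕ R j ≋ []) →
                   sumP (applyUpTo T (suc n)) ≋ L 0 ⊕ R n
  sumP-telescope zero    T L R split cancel = ≋-trans (⊕-identityʳ (T 0)) (split 0 ℕ.z≤n)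
  sumP-telescope (suc n) T L R split cancel = begin
    T 0 ⊕ sumP (applyUpTo (λ j → T (suc j)) (suc n))
      ≈⟨ ⊕-cong (split 0 ℕ.z≤n) (sumP-telescope n (λ j → T (suc j)) (λ j → L (suc j)) (λ j → R (suc j))
                                   (λ j j≤n → split (suc j) (ℕ.s≤s j≤n)) (λ j j<n → cancel (suc j) (ℕ.s≤s j<n))) ⟩
    (L 0 ⊕ R 0) ⊕ (L 1 ⊕ R (suc n))   ≈⟨ ⊕-assoc (L 0) (R 0) (L 1 ⊕ R (suc n)) ⟩
    L 0 ⊕ (R 0 ⊕ (L 1 ⊕ R (suc n)))   ≈⟨ ⊕-congˡ (L 0) (⊕-assoc (R 0) (L 1) (R (suc n))) ⟨
    L 0 ⊕ ((R 0 ⊕ L 1) ⊕ R (suc n))   ≈⟨ ⊕-congˡ (L 0) (⊕-congʳ (R (suc n))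
                                           (≋-trans (⊕-comm (R 0) (L 1)) (cancel 0 (ℕ.s≤s ℕ.z≤n)))) ⟩
    L 0 ⊕ R (suc n)                   ∎
    where open ≋-Reasoning

  module BracketTelescope (a : ℤ) (F : Poly) (b : ℤ) (G : Poly)
                          (F-lowest : Δ (𝒟 a F) ≋ deg a · F) (G-lowest : Δ (𝒟 b G) ≋ deg b · G) (n : ℕ) where

    A = deg a
    B = deg b

    left : ℕ → Poly
    left zero    = β A B 0 n · (Δ F ⊗ 𝒟^ n b G)
    left (suc j) = (β A B (suc j) (n ℕ.∸ suc j) K.* γ A j) · (𝒟^ j a F ⊗ 𝒟^ (n ℕ.∸ suc j) b G)

    right′ : ℕ → ℕ → Poly
    right′ j zero    = β A B j 0 · (𝒟^ j a F ⊗ Δ G)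
    right′ j (suc k) = (β A B j (suc k) K.* γ B k) · (𝒟^ j a F ⊗ 𝒟^ k b G)

    right : ℕ → Poly
    right j = right′ j (n ℕ.∸ j)

    left-part : ∀ j → β A B j (n ℕ.∸ j) · (Δ (𝒟^ j a F) ⊗ 𝒟^ (n ℕ.∸ j) b G) ≋ left j
    left-part zero    = ≋-refl
    left-part (suc j) = begin
      β A B (suc j) k · (Δ (𝒟^ (suc j) a F) ⊗ Y)    ≈⟨ ⋆-cong refl (⊗-congˡ Y (Δ-𝒟^ a F F-lowest j)) ⟩
      β A B (suc j) k · ((γ A j · 𝒟^ j a F) ⊗ Y)    ≈⟨ ≋-trans (⋆-cong refl (⋆-⊗ _ (𝒟^ j a F) Y)) (≋-sym (·-assoc _ _ _)) ⟩
      left (suc j)                                  ∎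
      where open ≋-Reasoning
            k = n ℕ.∸ suc j
            Y = 𝒟^ k b G

    right-part : ∀ j k → β A B j k · (𝒟^ j a F ⊗ Δ (𝒟^ k b G)) ≋ right′ j k
    right-part j zero    = ≋-refl
    right-part j (suc k) = begin
      β A B j (suc k) · (X ⊗ Δ (𝒟^ (suc k) b G))    ≈⟨ ⋆-cong refl (⊗-congʳ X (Δ-𝒟^ b G G-lowest k)) ⟩
      β A B j (suc k) · (X ⊗ (γ B k · 𝒟^ k b G))    ≈⟨ ≋-trans (⋆-cong refl (⊗-⋆ _ X (𝒟^ k b G))) (≋-sym (·-assoc _ _ _)) ⟩
      right′ j (suc k)                              ∎
      where open ≋-Reasoning
            X = 𝒟^ j a F

    split : ∀ j → Δ (bracket-term a F b G n j) ≋ left j ⊕ right j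
    split j = begin
      Δ (s · (X ⊗ Y))                ≈⟨ Δ-⋆ (ι s) (X ⊗ Y) ⟩
      s · Δ (X ⊗ Y)                  ≈⟨ ⋆-cong refl (Δ-⊗ X Y) ⟩
      s · (Δ X ⊗ Y ⊕ X ⊗ Δ Y)        ≈⟨ ⋆-distribˡ (ι s) (Δ X ⊗ Y) (X ⊗ Δ Y) ⟩
      s · (Δ X ⊗ Y) ⊕ s · (X ⊗ Δ Y)  ≈⟨ ⊕-cong (left-part j) (right-part j (n ℕ.∸ j)) ⟩
      left j ⊕ right j               ∎
      where open ≋-Reasoning
            s = β A B j (n ℕ.∸ j)
            X = 𝒟^ j a F
            Y = 𝒟^ (n ℕ.∸ j) b G

    cancel : ∀ j → j ℕ.< n → left (suc j) ⊕ right j ≋ []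
    cancel j j<n = begin
      left (suc j) ⊕ right′ j (n ℕ.∸ j)  ≡⟨ ≡.cong (λ m → left (suc j) ⊕ right′ j m) (ℕP.+-∸-assoc 1 j<n) ⟩
      c₁ · X ⊕ c₂ · X                    ≈⟨ ·-distribʳ c₁ c₂ X ⟨
      (c₁ K.+ c₂) · X                    ≈⟨ ·-cong (β-cancel A B j k) ≋-refl ⟩
      K.0# · X                           ≈⟨ ·-zeroˡ X ⟩
      []                                 ∎
      where open ≋-Reasoning
            k  = n ℕ.∸ suc j
            c₁ = β A B (suc j) k K.* γ A j
            c₂ = β A B j (suc k) K.* γ B k
            X  = 𝒟^ j a F ⊗ 𝒟^ k b G

    Δ-bracket : Δ (bracket a F b G n) ≋ β A B 0 n · (Δ F ⊗ 𝒟^ n b G) ⊕ β A B n 0 · (𝒟^ n a F ⊗ Δ G)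
    Δ-bracket = begin
      Δ (bracket a F b G n)
        ≡⟨ ≡.cong Δ (bracket≡sum a F b G n) ⟩
      Δ (sumP (applyUpTo (bracket-term a F b G n) (suc n)))
        ≈⟨ Δ-sumP (bracket-term a F b G n) (suc n) ⟩
      sumP (applyUpTo (λ j → Δ (bracket-term a F b G n j)) (suc n))
        ≈⟨ sumP-telescope n (λ j → Δ (bracket-term a F b G n j)) left right (λ j _ → split j) cancel ⟩
      left 0 ⊕ right′ n (n ℕ.∸ n)
        ≡⟨ ≡.cong (λ m → left 0 ⊕ right′ n m) (ℕP.n∸n≡0 n) ⟩
      left 0 ⊕ right′ n 0
        ∎
      where open ≋-Reasoning

  natK-*-invNat-self : ∀ k .{{_ : NonZero k}} → natK k K.* invNat k K.≈ K.1#
  natK-*-invNat-self k = K.trans (K.*-comm _ _) (invNat-natK k)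

  rising-deg-two : ∀ n → rising (deg two K.+ natK 0) n K.≈ natK (suc n) K.* natK (n !)
  rising-deg-two n = K.trans (rising-cong n (K.trans (K.+-identityʳ _) deg-two)) (K.trans (rising-2 n) (natR-* K.commutativeRing (suc n) (n !)))
    where
    rising-2 : ∀ n → rising (natK 2) n K.≈ natK (suc n !)
    rising-2 zero    = K.sym (K.+-identityʳ _)
    rising-2 (suc n) = K.trans (K.*-cong (rising-2 n) (K.sym (natR-+ K.commutativeRing 2 n)))
                               (K.trans (K.*-comm _ _) (K.sym (natR-* K.commutativeRing (suc (suc n)) (suc n !))))

  β-two-0 : ∀ B n → β (deg two) B 0 n K.≈ natK (suc n)
  β-two-0 B n = begin
    K.1# K.* rising (deg two K.+ natK 0) n K.* K.1# K.* invNat (1 ℕ.* n !)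
      ≈⟨ K.*-cong (K.*-congʳ (K.*-congˡ (rising-deg-two n))) (K.reflexive (≡.cong invNat (ℕP.*-identityˡ (n !)))) ⟩
    K.1# K.* (natK (suc n) K.* natK (n !)) K.* K.1# K.* invNat (n !)
      ≈⟨ KS.solve 3 (λ a b i → con 1 :* (a :* b) :* con 1 :* i := a :* (b :* i)) K.refl (natK (suc n)) (natK (n !)) (invNat (n !)) ⟩
    natK (suc n) K.* (natK (n !) K.* invNat (n !))
      ≈⟨ K.trans (K.*-congˡ (natK-*-invNat-self (n !) {{ℕP._!≢0 n}})) (K.*-identityʳ _) ⟩
    natK (suc n)
      ∎
    where open SetoidReasoning K.setoid
          open KS using (_:*_; _:=_; con)

  β-0-two : ∀ A n → β A (deg two) n 0 K.≈ sgn n K.* natK (suc n)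
  β-0-two A n = begin
    sgn n K.* K.1# K.* rising (deg two K.+ natK 0) n K.* invNat (n ! ℕ.* 1)
      ≈⟨ K.*-cong (K.*-congˡ (rising-deg-two n)) (K.reflexive (≡.cong invNat (ℕP.*-identityʳ (n !)))) ⟩
    sgn n K.* K.1# K.* (natK (suc n) K.* natK (n !)) K.* invNat (n !)
      ≈⟨ KS.solve 4 (λ s a b i → s :* con 1 :* (a :* b) :* i := (s :* a) :* (b :* i))
                    K.refl (sgn n) (natK (suc n)) (natK (n !)) (invNat (n !)) ⟩
    sgn n K.* natK (suc n) K.* (natK (n !) K.* invNat (n !))
      ≈⟨ K.trans (K.*-congˡ (natK-*-invNat-self (n !) {{ℕP._!≢0 n}})) (K.*-identityʳ _) ⟩
    sgn n K.* natK (suc n)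
      ∎
    where open SetoidReasoning K.setoid
          open KS using (_:*_; _:=_; con)

  Δ-⊖ : ∀ p q → Δ (p ⊖ q) ≋ Δ p ⊖ Δ q
  Δ-⊖ p q = ≋-trans (Δ-⊕ p _) (⊕-congˡ (Δ p) (Δ-⋆ _ q))

  ⊖-cancel : ∀ {u v} Q → u K.≈ v → u · Q ⊖ v · Q ≋ []
  ⊖-cancel {u} {v} Q u≈v = begin
    u · Q ⊕ (K.- K.1#) · v · Q       ≈⟨ ⊕-congˡ (u · Q) (·-assoc (K.- K.1#) v Q) ⟨
    u · Q ⊕ (K.- K.1# K.* v) · Q     ≈⟨ ·-distribʳ u _ Q ⟨
    (u K.+ K.- K.1# K.* v) · Q       ≈⟨ ·-cong (K.trans (K.+-cong u≈v (-1*x≈-x v)) (K.-‿inverseʳ v)) ≋-refl ⟩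
    K.0# · Q                         ≈⟨ ·-zeroˡ Q ⟩
    []                               ∎
    where open ≋-Reasoning
          open RingProperties K.ring using (-1*x≈-x)

  Δ-ϑ : ∀ n a f → Δ (ϑ n a f) ≋ []
  Δ-ϑ n a f = begin
    Δ (𝒟^ (suc n) a F ⊖ λ′ · B)                   ≈⟨ Δ-⊖ (𝒟^ (suc n) a F) (λ′ · B) ⟩
    Δ (𝒟^ (suc n) a F) ⊖ Δ (λ′ · B)               ≈⟨ ⊕-cong (Δ-𝒟^ a F (Δ-𝒟-const a f) n) (⋆-cong refl Δ-λ′B) ⟩
    γ (deg a) n · Q ⊖ (λ′ K.* natK (suc n)) · Q   ≈⟨ ⊖-cancel Q γ≈λ′[1+n] ⟩
    []                                            ∎
    where
    open ≋-Reasoning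
    F  = const f
    Q  = 𝒟^ n a F
    λ′ = natK n K.+ deg a
    B  = bracket two E₂ a F n
    module Br = BracketTelescope two E₂ a F Δ-𝒟-E₂ (Δ-𝒟-const a f) n
    Δ-λ′B : Δ (λ′ · B) ≋ (λ′ K.* natK (suc n)) · Q
    Δ-λ′B = begin
      Δ (λ′ · B)
        ≈⟨ ≋-trans (Δ-⋆ (ι λ′) B) (⋆-cong refl Br.Δ-bracket) ⟩
      λ′ · (β (deg two) (deg a) 0 n · (Δ E₂ ⊗ Q) ⊕ β (deg two) (deg a) n 0 · (𝒟^ n two E₂ ⊗ Δ F))
        ≈⟨ ⋆-cong refl (⊕-cong (·-cong (β-two-0 (deg a) n) (≋-trans (⊗-congˡ Q Δ-E₂) (⊗-identityˡ Q)))
                               (⋆-cong refl (≋-trans (⊗-congʳ (𝒟^ n two E₂) (Δ-const f)) (⊗-zeroʳ (𝒟^ n two E₂))))) ⟩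
      λ′ · (natK (suc n) · Q ⊕ [])
        ≈⟨ ≋-trans (⋆-cong refl (⊕-identityʳ (natK (suc n) · Q))) (≋-sym (·-assoc λ′ _ Q)) ⟩
      (λ′ K.* natK (suc n)) · Q
        ∎
    γ≈λ′[1+n] : γ (deg a) n K.≈ λ′ K.* natK (suc n)
    γ≈λ′[1+n] = KS.solve 2 (λ κ t → (con 1 :+ t) :* (κ :+ t) := (t :+ κ) :* (con 1 :+ t)) K.refl (deg a) (natK n)
      where open KS using (_:+_; _:*_; _:=_; con)

  Δ-ϑE₂ : ∀ n → Δ (ϑE₂ n) ≋ []
  Δ-ϑE₂ n = begin
    Δ (c₀ · 𝒟^ (suc n) two E₂ ⊖ μ · B)            ≈⟨ Δ-⊖ (c₀ · 𝒟^ (suc n) two E₂) (μ · B) ⟩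
    Δ (c₀ · 𝒟^ (suc n) two E₂) ⊖ Δ (μ · B)        ≈⟨ ⊕-cong Δ-c₀D^E₂ (⋆-cong refl Δ-μB) ⟩
    (c₀ K.* γ (deg two) n) · Q ⊖ (μ K.* ν) · Q    ≈⟨ ⊖-cancel Q c₀γ≈μν ⟩
    []                                            ∎
    where
    open ≋-Reasoning
    c₀ = K.1# K.+ sgn n
    μ  = natK n K.+ natK 2
    ν  = natK (suc n) K.+ sgn n K.* natK (suc n)
    Q  = 𝒟^ n two E₂
    B  = bracket two E₂ two E₂ n
    module Br = BracketTelescope two E₂ two E₂ Δ-𝒟-E₂ Δ-𝒟-E₂ n
    Δ-c₀D^E₂ : Δ (c₀ · 𝒟^ (suc n) two E₂) ≋ (c₀ K.* γ (deg two) n) · Q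
    Δ-c₀D^E₂ = ≋-trans (Δ-⋆ (ι c₀) (𝒟^ (suc n) two E₂))
                       (≋-trans (⋆-cong refl (Δ-𝒟^ two E₂ Δ-𝒟-E₂ n)) (≋-sym (·-assoc c₀ _ Q)))
    Δ-μB : Δ (μ · B) ≋ (μ K.* ν) · Q
    Δ-μB = begin
      Δ (μ · B)
        ≈⟨ ≋-trans (Δ-⋆ (ι μ) B) (⋆-cong refl Br.Δ-bracket) ⟩
      μ · (β (deg two) (deg two) 0 n · (Δ E₂ ⊗ Q) ⊕ β (deg two) (deg two) n 0 · (Q ⊗ Δ E₂))
        ≈⟨ ⋆-cong refl (⊕-cong (·-cong (β-two-0 (deg two) n) (≋-trans (⊗-congˡ Q Δ-E₂) (⊗-identityˡ Q)))
                               (·-cong (β-0-two (deg two) n) (≋-trans (⊗-congʳ Q Δ-E₂) (⊗-identityʳ Q)))) ⟩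
      μ · (natK (suc n) · Q ⊕ (sgn n K.* natK (suc n)) · Q)
        ≈⟨ ≋-trans (⋆-cong refl (≋-sym (·-distribʳ _ _ Q))) (≋-sym (·-assoc μ ν Q)) ⟩
      (μ K.* ν) · Q
        ∎
    c₀γ≈μν : c₀ K.* γ (deg two) n K.≈ μ K.* ν
    c₀γ≈μν = K.trans (K.*-congˡ (K.*-congˡ (K.+-congʳ deg-two)))
      (KS.solve 2 (λ s t → (con 1 :+ s) :* ((con 1 :+ t) :* ((con 1 :+ (con 1 :+ con 0)) :+ t))
                         := (t :+ (con 1 :+ (con 1 :+ con 0))) :* ((con 1 :+ t) :+ s :* (con 1 :+ t))) K.refl (sgn n) (natK n))
      where open KS using (_:+_; _:*_; _:=_; con)

  -- Homogeneity

  Homogeneous : ℤ → Poly → Set ℓ₅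
  Homogeneous a []      = ⊤
  Homogeneous a (x ∷ p) = Hom a x × Homogeneous (a ℤ.- two) p

  Homogeneous-resp : ∀ {a} p q → p ≋ q → Homogeneous a p → Homogeneous a q
  Homogeneous-resp p       []      e hp        = tt
  Homogeneous-resp []      (y ∷ q) e hp        = Hom-resp (at e 0) Hom-0 , Homogeneous-resp [] q (≋-sym (≋[]-tail (≋-sym e))) tt
  Homogeneous-resp (x ∷ p) (y ∷ q) e (hx , hp) = Hom-resp (at e 0) hx , Homogeneous-resp p q (≋-tail e) hp

  Homogeneous-⊕ : ∀ {a} p q → Homogeneous a p → Homogeneous a q → Homogeneous a (p ⊕ q)
  Homogeneous-⊕ []      q       hp        hq        = hq
  Homogeneous-⊕ (x ∷ p) []      hp        hq        = hp
  Homogeneous-⊕ (x ∷ p) (y ∷ q) (hx , hp) (hy , hq) = Hom-+ hx hy , Homogeneous-⊕ p q hp hq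

  Homogeneous-⋆ : ∀ {a b x} p → Hom b x → Homogeneous a p → Homogeneous (b ℤ.+ a) (x ⋆ p)
  Homogeneous-⋆         []      hx hp        = tt
  Homogeneous-⋆ {a} {b} (y ∷ p) hx (hy , hp) =
    Hom-* hx hy , ≡.subst (λ d → Homogeneous d _) (b+[a-t]≡[b+a]-t a b) (Homogeneous-⋆ p hx hp)
    where
    b+[a-t]≡[b+a]-t : ∀ a b → b ℤ.+ (a ℤ.- two) ≡ (b ℤ.+ a) ℤ.- two
    b+[a-t]≡[b+a]-t a b = ℤSolver.solve 3 (λ a b t → b :+ (a :- t) := (b :+ a) :- t) ≡.refl a b two
      where open ℤSolver using (_:+_; _:-_; _:=_)

  Homogeneous-· : ∀ {a} l p → Homogeneous a p → Homogeneous a (l · p)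
  Homogeneous-· l []      hp        = tt
  Homogeneous-· l (y ∷ p) (hy , hp) = Hom-ι* l hy , Homogeneous-· l p hp

  Homogeneous-⊖ : ∀ {a} p q → Homogeneous a p → Homogeneous a q → Homogeneous a (p ⊖ q)
  Homogeneous-⊖ p q hp hq = Homogeneous-⊕ p ((K.- K.1#) · q) hp (Homogeneous-· (K.- K.1#) q hq)

  Homogeneous-⊗ : ∀ {a b} p q → Homogeneous a p → Homogeneous b q → Homogeneous (a ℤ.+ b) (p ⊗ q)
  Homogeneous-⊗         []      q hp        hq = tt
  Homogeneous-⊗ {a} {b} (x ∷ p) q (hx , hp) hq =
    Homogeneous-⊕ (x ⋆ q) (0# ∷ p ⊗ q) (Homogeneous-⋆ q hx hq)
      (Hom-0 , ≡.subst (λ d → Homogeneous d (p ⊗ q)) ([a-t]+b≡[a+b]-t a b) (Homogeneous-⊗ p q hp hq))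
    where
    [a-t]+b≡[a+b]-t : ∀ a b → (a ℤ.- two) ℤ.+ b ≡ (a ℤ.+ b) ℤ.- two
    [a-t]+b≡[a+b]-t a b = ℤSolver.solve 3 (λ a b t → (a :- t) :+ b := (a :+ b) :- t) ≡.refl a b two
      where open ℤSolver using (_:+_; _:-_; _:=_)

  Homogeneous-map-∂ : ∀ {a} p → Homogeneous a p → Homogeneous (a ℤ.+ two) (map ∂ p)
  Homogeneous-map-∂     []      hp        = tt
  Homogeneous-map-∂ {a} (x ∷ p) (hx , hp) =
    ∂-deg hx , ≡.subst (λ d → Homogeneous d (map ∂ p)) [a-t]+t≡[a+t]-t (Homogeneous-map-∂ p hp)
    where
    [a-t]+t≡[a+t]-t : (a ℤ.- two) ℤ.+ two ≡ (a ℤ.+ two) ℤ.- two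
    [a-t]+t≡[a+t]-t = ℤSolver.solve 2 (λ a t → (a :- t) :+ t := (a :+ t) :- t) ≡.refl a two
      where open ℤSolver using (_:+_; _:-_; _:=_)

  Homogeneous-weigh : ∀ {a} b i p → Homogeneous a p → Homogeneous a (weigh b i p)
  Homogeneous-weigh b i []      hp        = tt
  Homogeneous-weigh b i (x ∷ p) (hx , hp) = Hom-ι* _ hx , Homogeneous-weigh b (suc i) p hp

  Homogeneous-Δ : ∀ {a} p → Homogeneous a p → Homogeneous (a ℤ.- two) (Δ p)
  Homogeneous-Δ []      hp        = tt
  Homogeneous-Δ (x ∷ p) (hx , hp) = Homogeneous-⊕ p (0# ∷ Δ p) hp (Hom-0 , Homogeneous-Δ p hp)

  Homogeneous-sumP : ∀ {a} k (T : ℕ → Poly) → (∀ j → j ℕ.< k → Homogeneous a (T j)) → Homogeneous a (sumP (applyUpTo T k))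
  Homogeneous-sumP zero    T hT = tt
  Homogeneous-sumP (suc k) T hT =
    Homogeneous-⊕ (T 0) _ (hT 0 (ℕ.s≤s ℕ.z≤n)) (Homogeneous-sumP k (λ j → T (suc j)) (λ j j<k → hT (suc j) (ℕ.s≤s j<k)))

  Homogeneous-E₂ : Homogeneous two E₂
  Homogeneous-E₂ = Hom-0 , ≡.subst (λ d → Hom d 1#) (≡.sym (ℤP.+-inverseʳ two)) Hom-1 , tt

  module _ (E₄-hom : Hom (ℤ.+ (4 ℕ.* N)) E₄) where

    Homogeneous-𝒟 : ∀ {a} p → Homogeneous a p → Homogeneous (a ℤ.+ two) (𝒟 a p)
    Homogeneous-𝒟 {a} p hp = Homogeneous-resp (𝒟′ a p) (𝒟 a p) (≋-sym (𝒟≋𝒟′ a p))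
      (Homogeneous-⊕ (map ∂ p ⊕ (0# ∷ weigh a 0 p)) (E₄ ⋆ Δ p)
        (Homogeneous-⊕ (map ∂ p) (0# ∷ weigh a 0 p) (Homogeneous-map-∂ p hp)
          (Hom-0 , ≡.subst (λ d → Homogeneous d (weigh a 0 p)) a≡[a+t]-t (Homogeneous-weigh a 0 p hp)))
        (≡.subst (λ d → Homogeneous d (E₄ ⋆ Δ p)) 4N+[a-t]≡a+t (Homogeneous-⋆ (Δ p) E₄-hom (Homogeneous-Δ p hp))))
      where
      open ℤSolver using (_:+_; _:-_; _:=_)
      a≡[a+t]-t : a ≡ (a ℤ.+ two) ℤ.- two
      a≡[a+t]-t = ℤSolver.solve 2 (λ a t → a := (a :+ t) :- t) ≡.refl a two
      4N+[a-t]≡a+t : ℤ.+ (4 ℕ.* N) ℤ.+ (a ℤ.- two) ≡ a ℤ.+ two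
      4N+[a-t]≡a+t = ≡.trans (≡.cong (λ d → d ℤ.+ (a ℤ.- two)) four≡two+two)
                            (ℤSolver.solve 2 (λ a t → (t :+ t) :+ (a :- t) := a :+ t) ≡.refl a two)

    Homogeneous-𝒟^ : ∀ {a} p → Homogeneous a p → ∀ m → Homogeneous (a ℤ.+ raise m) (𝒟^ m a p)
    Homogeneous-𝒟^ {a} p hp zero    = ≡.subst (λ d → Homogeneous d p) (≡.sym (a+raise0≡a a)) hp
    Homogeneous-𝒟^ {a} p hp (suc m) = ≡.subst (λ d → Homogeneous d (𝒟^ (suc m) a p)) [a+r]+t≡a+raise-suc
      (Homogeneous-𝒟 (𝒟^ m a p) (Homogeneous-𝒟^ p hp m))
      where
      [a+r]+t≡a+raise-suc : (a ℤ.+ raise m) ℤ.+ two ≡ a ℤ.+ raise (suc m)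
      [a+r]+t≡a+raise-suc = ≡.trans (ℤSolver.solve 3 (λ a r t → (a :+ r) :+ t := a :+ (t :+ r)) ≡.refl a (raise m) two)
                                    (≡.cong (λ r → a ℤ.+ r) (≡.sym (raise-suc m)))
        where open ℤSolver using (_:+_; _:=_)

    Homogeneous-bracket : ∀ {a b} F G n → Homogeneous a F → Homogeneous b G →
                          Homogeneous ((a ℤ.+ b) ℤ.+ raise n) (bracket a F b G n)
    Homogeneous-bracket {a} {b} F G n hF hG = ≡.subst (Homogeneous _) (≡.sym (bracket≡sum a F b G n))
      (Homogeneous-sumP (suc n) (bracket-term a F b G n) λ { j (ℕ.s≤s j≤n) →
        Homogeneous-· (β (deg a) (deg b) j (n ℕ.∸ j)) (𝒟^ j a F ⊗ 𝒟^ (n ℕ.∸ j) b G)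
          (≡.subst (λ d → Homogeneous d (𝒟^ j a F ⊗ 𝒟^ (n ℕ.∸ j) b G)) (degree j≤n)
            (Homogeneous-⊗ (𝒟^ j a F) (𝒟^ (n ℕ.∸ j) b G) (Homogeneous-𝒟^ F hF j) (Homogeneous-𝒟^ G hG (n ℕ.∸ j)))) })
      where
      degree : ∀ {j} → j ℕ.≤ n → (a ℤ.+ raise j) ℤ.+ (b ℤ.+ raise (n ℕ.∸ j)) ≡ (a ℤ.+ b) ℤ.+ raise n
      degree {j} j≤n = ≡.trans
        (ℤSolver.solve 4 (λ a b x y → (a :+ x) :+ (b :+ y) := (a :+ b) :+ (x :+ y)) ≡.refl a b (raise j) (raise (n ℕ.∸ j)))
        (≡.cong (λ r → (a ℤ.+ b) ℤ.+ r) (≡.trans (≡.sym (ℤP.pos-+ (2 ℕ.* N ℕ.* j) _))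
          (≡.cong ℤ.+_ (≡.trans (≡.sym (ℕP.*-distribˡ-+ (2 ℕ.* N) j (n ℕ.∸ j)))
                                (≡.cong (2 ℕ.* N ℕ.*_) (ℕP.m+[n∸m]≡n j≤n))))))
        where open ℤSolver using (_:+_; _:=_)

    ϑ-homogeneous : ∀ n a f → Hom a f → Homogeneous (a ℤ.+ two ℤ.+ raise n) (ϑ n a f)
    ϑ-homogeneous n a f hf = Homogeneous-⊖ D^F (λ′ · B)
      (≡.subst (λ d → Homogeneous d D^F) a+raise-suc≡a+two+raise (Homogeneous-𝒟^ (const f) (hf , tt) (suc n)))
      (Homogeneous-· λ′ B (≡.subst (λ d → Homogeneous (d ℤ.+ raise n) B) (ℤP.+-comm two a)
        (Homogeneous-bracket E₂ (const f) n Homogeneous-E₂ (hf , tt))))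
      where
      D^F = 𝒟^ (suc n) a (const f)
      λ′  = natK n K.+ deg a
      B   = bracket two E₂ a (const f) n
      a+raise-suc≡a+two+raise : a ℤ.+ raise (suc n) ≡ a ℤ.+ two ℤ.+ raise n
      a+raise-suc≡a+two+raise = ≡.trans (≡.cong (λ r → a ℤ.+ r) (raise-suc n)) (≡.sym (ℤP.+-assoc a two (raise n)))

    ϑE₂-homogeneous : ∀ n → Homogeneous (ℤ.+ (4 ℕ.* N) ℤ.+ raise n) (ϑE₂ n)
    ϑE₂-homogeneous n = Homogeneous-⊖ (c₀ · D^E₂) (μ · B)
      (Homogeneous-· c₀ D^E₂ (≡.subst (λ d → Homogeneous d D^E₂) two+raise-suc≡4N+raise
        (Homogeneous-𝒟^ E₂ Homogeneous-E₂ (suc n))))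
      (Homogeneous-· μ B (≡.subst (λ d → Homogeneous (d ℤ.+ raise n) B) (≡.sym four≡two+two)
        (Homogeneous-bracket E₂ E₂ n Homogeneous-E₂ Homogeneous-E₂)))
      where
      c₀   = K.1# K.+ sgn n
      μ    = natK n K.+ natK 2
      D^E₂ = 𝒟^ (suc n) two E₂
      B    = bracket two E₂ two E₂ n
      two+raise-suc≡4N+raise : two ℤ.+ raise (suc n) ≡ ℤ.+ (4 ℕ.* N) ℤ.+ raise n
      two+raise-suc≡4N+raise = ≡.trans (≡.cong (λ r → two ℤ.+ r) (raise-suc n))
        (≡.trans (≡.sym (ℤP.+-assoc two two (raise n))) (≡.cong (ℤ._+ raise n) (≡.sym four≡two+two)))

  InM-fromΔ≋[] : ∀ {a} p → Homogeneous a p → Δ p ≋ [] → InM a p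
  InM-fromΔ≋[] []      hp        Δp≋[] = tt
  InM-fromΔ≋[] (x ∷ p) (hx , hp) Δp≋[] =
    hx , all-zero p (λ j → cancel-natK j (trans (sym (coeff-Δ (x ∷ p) j)) (at Δp≋[] j)))
    where
    all-zero : ∀ p → (∀ j → coeff p j ≈ 0#) → All (_≈ 0#) p
    all-zero []      z = All.[]
    all-zero (x ∷ p) z = z 0 All.∷ all-zero p (λ j → z (suc j))
    cancel-natK : ∀ j {y} → ι (natK (suc j)) * y ≈ 0# → y ≈ 0#
    cancel-natK j {y} e = begin
      y                                              ≈⟨ trans (*-congʳ ι-1) (*-identityˡ y) ⟨
      ι K.1# * y                                     ≈⟨ *-congʳ (ι-cong (invNat-natK (suc j))) ⟨
      ι (invNat (suc j) K.* natK (suc j)) * y        ≈⟨ ι-*-assoc _ _ y ⟨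
      ι (invNat (suc j)) * (ι (natK (suc j)) * y)    ≈⟨ trans (*-congˡ e) (zeroʳ _) ⟩
      0#                                             ∎
      where open SetoidReasoning setoid

theorem1p2 : ∀ {c ℓ m ℓm h : Level} (K : Field c ℓ) (char0 : CharZero K)
    (N : ℕ) {{nz : NonZero N}}
    (M : GradedAlgebra K m ℓm h) (δ : Derivation K M N)
    (E₄ : GradedAlgebra.Carrier M) → GradedAlgebra.Hom M (ℤ.+ (4 ℕ.* N)) E₄ →
    (n : ℕ) (a : ℤ) (f : GradedAlgebra.Carrier M) → GradedAlgebra.Hom M a f →
    Theory.InM K char0 N M δ E₄ (a ℤ.+ ℤ.+ (2 ℕ.* N) ℤ.+ ℤ.+ (2 ℕ.* N ℕ.* n))
      (Theory.ϑ K char0 N M δ E₄ n a f)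
    × Theory.InM K char0 N M δ E₄ (ℤ.+ (4 ℕ.* N) ℤ.+ ℤ.+ (2 ℕ.* N ℕ.* n))
      (Theory.ϑE₂ K char0 N M δ E₄ n)
theorem1p2 K char0 N M δ E₄ E₄-hom n a f f-hom =
    InM-fromΔ≋[] (ϑ n a f) (ϑ-homogeneous E₄-hom n a f f-hom) (Δ-ϑ n a f)
  , InM-fromΔ≋[] (ϑE₂ n) (ϑE₂-homogeneous E₄-hom n) (Δ-ϑE₂ n)
  where open M̃ K char0 N M δ E₄
        open Theory K char0 N M δ E₄ using (ϑ; ϑE₂)
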